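{- Let $\mathcal{F}$ be a maximal intersecting subfamily of $\mathcal{P}([n])$ that is $\emptyset$-minimal. Then there exist non-negative reals $(c_a)_{a \in [n]}$ with $\sum_{a\in[n]} c_a = 1$ and non-negative reals $(\lambda_{(A,B)})_{A \subseteq B \subseteq [n]}$ such that \[ \overline{\mathcal{F}} = \sum_{a \in [n]} c_a \, \overline{\mathcal{S}_a(\mathcal{P}([n]))} + \sum_{A \subseteq B \subseteq [n]} \lambda_{(A,B)} (e_B - e_A). \]
   Context: $[n] = \{1,\dots,n\}$, $\mathcal{P}([n])$ is the power set, $\oplus$ is symmetric difference, complements are in $[n]$. A family is intersecting if any two members intersect; a maximal intersecting subfamily of $\mathcal{P}([n])$ is one not properly contained in another intersecting subfamily. $\mathcal{F}^* = \{A^c : A \in \mathcal{F}\}$. $\mathcal{S}_a(\mathcal{P}([n])) = \{A \subseteq [n] : a \in A\}$. For $\mathcal{F} \subseteq \mathcal{P}([n])$, $\overline{\mathcal{F}} = \sum_{A \subseteq [n]} \epsilon_A e_A \in \mathbb{R}^{\mathcal{P}([n])}$ with $\epsilon_A = 1$ if $A \in \mathcal{F}, A^c \notin \mathcal{F}$; $\epsilon_A = -1$ if $A \notin \mathcal{F}, A^c \in \mathcal{F}$; $\epsilon_A = 0$ otherwise. Let $\Sigma$ be the set of permutations of $[n]$; for $\sigma \in \Sigma$, $X \subseteq [n]$ let $P^{\sigma,X}_0 = X$, $P^{\sigma,X}_k = P^{\sigma,X}_{k-1} \oplus \{\sigma(k)\}$ ($k \in [n]$). For a family $\mathcal{G}$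 define $\Lambda(\mathcal{G}) \in \mathbb{R}^{\mathcal{P}([n])\times\mathcal{P}([n])}$ by $\Lambda(\mathcal{G}) = \sum_{\sigma\in\Sigma}\sum_{X \in \mathcal{G}}\sum_{k\in[n]} ( e_{(P^{\sigma,X}_{k-1}, P^{\sigma,X}_k)} - e_{(P^{\sigma,X}_k, P^{\sigma,X}_{k-1})})$, where $e_{(Y,Z)}$ is the standard basis. $\mathcal{F}$ is called $\emptyset$-minimal if for every $a \in [n]$, $\Lambda(\mathcal{F}^*)_{(\emptyset, \{a\})} = \min\{\Lambda(\mathcal{F}^*)_{(A, A\cup\{a\})} : A \subseteq [n]\setminus\{a\}\}$. -}

module Defs where

open import Data.Bool using (Bool; true; false; not; _∧_; _∨_; _xor_; if_then_else_)
open import Data.Nat using (ℕ; zero; suc)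
open import Data.Fin using (Fin; zero; suc)
open import Data.Fin.Subset using (Subset; ⁅_⁆; ∁; _∪_; _∩_; Nonempty; _∈_; _∉_; ⊥)
open import Data.Vec using (Vec; []; _∷_; zipWith)
open import Data.List using (List; []; _∷_; _++_; map; concatMap; allFin; foldr; length)
open import Data.Integer using (ℤ; +_; _-_)
open import Data.Rational using (ℚ; 0ℚ; 1ℚ; _+_; _*_; -_)
open import Relation.Binary.PropositionalEquality using (_≡_)

Family : ℕ → Set
Family n = Subset n → Bool

eqB : Bool → Bool → Bool
eqB true  b = b
eqB false b = not b

eqSub : ∀ {n} → Subset n → Subset n → Bool
eqSub [] [] = true
eqSub (x ∷ xs) (y ∷ ys) = eqB x y ∧ eqSub xs ys

subB : ∀ {n} → Subset n → Subset n → Bool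
subB [] [] = true
subB (x ∷ xs) (y ∷ ys) = (not x ∨ y) ∧ subB xs ys

_⊕_ : ∀ {n} → Subset n → Subset n → Subset n
_⊕_ = zipWith _xor_

allSubsets : ∀ n → List (Subset n)
allSubsets zero = [] ∷ []
allSubsets (suc n) = concatMap (λ s → (true ∷ s) ∷ (false ∷ s) ∷ []) (allSubsets n)

Intersecting : ∀ {n} → Family n → Set
Intersecting F = ∀ A B → F A ≡ true → F B ≡ true → Nonempty (A ∩ B)

MaximalIntersecting : ∀ {n} → Family n → Set
MaximalIntersecting {n} F =
  Intersecting F ×' (∀ (G : Family n) → Intersecting G →
     (∀ A → F A ≡ true → G A ≡ true) → ∀ A → G A ≡ true → F A ≡ true)
  where
  open import Data.Product using () renaming (_×_ to _×'_)

star : ∀ {n} → Family n → Family n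
star F A = F (∁ A)

S-fam : ∀ {n} → Fin n → Family n
S-fam a A = Data.Vec.lookup A a
  where import Data.Vec

bar : ∀ {n} → Family n → Subset n → ℚ
bar F A with F A | F (∁ A)
... | true  | false = 1ℚ
... | false | true  = - 1ℚ
... | _     | _     = 0ℚ

e : ∀ {n} → Subset n → Subset n → ℚ
e B C = if eqSub B C then 1ℚ else 0ℚ

sumℚ : ∀ {A : Set} → List A → (A → ℚ) → ℚ
sumℚ xs f = foldr (λ x r → f x + r) 0ℚ xs

-- permutations of [n], as sequences (σ(1),…,σ(n)) without repetition
seqs : ∀ n (k : ℕ) → List (List (Fin n))
seqs n zero = [] ∷ []
seqs n (suc k) = concatMap (λ s → map (λ i → i ∷ s) (allFin n)) (seqs n k)

eqFin : ∀ {n} → Fin n → Fin n → Bool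
eqFin zero zero = true
eqFin (suc i) (suc j) = eqFin i j
eqFin _ _ = false

elemB : ∀ {n} → Fin n → List (Fin n) → Bool
elemB i [] = false
elemB i (j ∷ js) = eqFin i j ∨ elemB i js

noDup : ∀ {n} → List (Fin n) → Bool
noDup [] = true
noDup (i ∷ is) = not (elemB i is) ∧ noDup is

filterB : ∀ {A : Set} → (A → Bool) → List A → List A
filterB p [] = []
filterB p (x ∷ xs) = if p x then x ∷ filterB p xs else filterB p xs

perms : ∀ n → List (List (Fin n))
perms n = filterB noDup (seqs n n)

-- the steps (P_{k-1}, P_k), k = 1..n, of the path P^{σ,X}
data Pair (A : Set) : Set where
  ⟨_,_⟩ : A → A → Pair A

steps : ∀ {n} → Subset n → List (Fin n) → List (Pair (Subset n))
steps X [] = []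
steps X (i ∷ is) = ⟨ X , X ⊕ ⁅ i ⁆ ⟩ ∷ steps (X ⊕ ⁅ i ⁆) is

countB : ∀ {A : Set} → (A → Bool) → List A → ℕ
countB p xs = length (filterB p xs)

allSteps : ∀ {n} → Family n → List (Pair (Subset n))
allSteps {n} G =
  concatMap (λ σ → concatMap (λ X → steps X σ) (filterB G (allSubsets n))) (perms n)

Λ : ∀ {n} → Family n → Subset n → Subset n → ℤ
Λ G Y Z =
  (+ countB (λ { ⟨ U , V ⟩ → eqSub U Y ∧ eqSub V Z }) (allSteps G))
  - (+ countB (λ { ⟨ U , V ⟩ → eqSub V Y ∧ eqSub U Z }) (allSteps G))

-- ∅-minimal: Λ(F*)_{(∅,{a})} is the minimum over A ⊆ [n]∖{a} of Λ(F*)_{(A, A∪{a})}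
-- (∅ is itself a candidate, so "equals the minimum" = "≤ every candidate")
EmptyMinimal : ∀ {n} → Family n → Set
EmptyMinimal {n} F = ∀ (a : Fin n) (A : Subset n) → a ∉ A →
  Λ (star F) ⊥ ⁅ a ⁆ Data.Integer.≤ Λ (star F) A (A ∪ ⁅ a ⁆)
  where import Data.Integer

-- Let N be the number of permutations of [n]. Each path P^{σ,X} from X ∈ F* runs to X^c, so the sum of
-- e_{P_k} − e_{P_{k-1}} over all steps of all these paths telescopes to N · F̄. Every step flips one
-- coordinate, i.e. traverses an up-edge (A, A ∪ {a}), a ∉ A, forwards or backwards, so the same sum is
-- Σ Λ(F*)_{(A, A∪{a})} (e_{A∪{a}} − e_A) over all up-edges. For fixed a these up-edges sum to S̄_a, so with
-- c_a = Λ(F*)_{(∅,{a})} / N and λ_{(A,A∪{a})} = (Λ(F*)_{(A,A∪{a})} − Λ(F*)_{(∅,{a})}) / N the identity becomes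
-- the claimed decomposition, and ∅-minimality says λ ≥ 0. Evaluating at ∅, where F̄ = −1 because ∅ ∉ F ∋ [n],
-- gives Σ_a c_a = 1. Finally c_a ≥ 0: F* is closed under subsets, and a backward traversal of (∅, {a}) on the
-- path from X is a forward traversal on the path from X ⊕ {a}, which starts in F* whenever it can traverse (∅, {a}).

module Submission where

open import Defs
open import Data.Nat using (ℕ; _≥_)
open import Data.Fin using (Fin)
open import Data.Fin.Subset using (Subset)
open import Data.List using (allFin)
open import Data.Bool using (true)
open import Data.Product using (Σ; _×_; _,_)
open import Data.Rational using (ℚ; 0ℚ; 1ℚ; _≤_; _+_; _*_; _-_)
open import Relation.Binary.PropositionalEquality using (_≡_)

open import Data.Bool using (Bool; false; not; _∧_; _∨_; _xor_)
open import Data.Bool.Properties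
  using (∧-comm; ∧-zeroʳ; ∨-zeroʳ; not-involutive; xor-assoc; xor-comm; xor-identityʳ; xor-same; true-xor)
open import Data.Nat using (zero; suc; s≤s; z≤n)
open import Data.Fin as Fin using (zero; suc)
open import Data.Fin.Subset
  using (⁅_⁆; ∁; _∪_; _∩_; ⊥; ⊤; ∣_∣; Nonempty; _∈_; _∉_; _⊆_)
open import Data.Fin.Subset.Properties
  using (∣p∣≡n⇒p≡⊤; ∉⊥; ∈⊤; x∈p∩q⁺; x∈p∩q⁻; ∩-comm; p⊆q⇒∁p⊇∁q; p⊆p∪q; ∪-identityˡ; ∪-identityʳ)
open import Data.Vec using ([]; _∷_; lookup)
open import Data.Vec.Properties
  using (lookup-zipWith; lookup-map; lookup-replicate; []=⇒lookup;
         tabulate∘lookup; tabulate-cong; zipWith-assoc; zipWith-comm; zipWith-identityʳ)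
open import Data.List using (List; []; _∷_; _++_; map; concatMap; tabulate; length)
open import Data.List.Properties using (map-tabulate; length-tabulate)
open import Data.List.Relation.Unary.All using (All; []; _∷_; universal)
import Data.List.Relation.Unary.All as All
open import Data.List.Relation.Unary.All.Properties using (concat⁺; map⁺)
open import Data.List.Relation.Unary.Any using (here; there)
open import Data.List.Membership.Propositional using (lose) renaming (_∈_ to _∈ₗ_)
open import Data.List.Membership.Propositional.Properties
  using (∈-concatMap⁺; ∈-map⁺; ∈-allFin)
open import Data.Product using (proj₁; proj₂)
open import Data.Rational using (-_; 1/_; NonZero; Positive; positive; nonNegative; toℚᵘ)
open import Data.Rational.Base using (*≤*)
open import Data.Rational.Literals using (fromℤ)
import Data.Rational.Properties as ℚ
import Data.Rational.Unnormalised as ℚᵘ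
import Data.Rational.Unnormalised.Properties as ℚᵘ
open import Data.Rational.Solver using (module +-*-Solver)
open +-*-Solver using (solve; _:+_; _:-_; _:*_; :-_; _:=_; con)
import Data.Integer as ℤ
import Data.Integer.Properties as ℤ
import Data.Integer.Solver as ℤ-Solver
open import Relation.Binary.PropositionalEquality
  using (refl; sym; trans; cong; cong₂; subst; subst₂; _≢_; module ≡-Reasoning)
open import Relation.Nullary using (contradiction)

𝟙 : Bool → ℚ
𝟙 true  = 1ℚ
𝟙 false = 0ℚ

𝟙-∧ : ∀ x y → 𝟙 (x ∧ y) ≡ 𝟙 x * 𝟙 y
𝟙-∧ true  y = sym (ℚ.*-identityˡ (𝟙 y))
𝟙-∧ false y = sym (ℚ.*-zeroˡ (𝟙 y))

0≤𝟙 : ∀ b → 0ℚ ≤ 𝟙 b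
0≤𝟙 true  = ℚ.nonNegative⁻¹ 1ℚ
0≤𝟙 false = ℚ.≤-refl

0≤*0≤⇒0≤* : ∀ {p q} → 0ℚ ≤ p → 0ℚ ≤ q → 0ℚ ≤ p * q
0≤*0≤⇒0≤* {p} {q} 0≤p 0≤q =
  ℚ.nonNegative⁻¹ (p * q) {{ℚ.nonNeg*nonNeg⇒nonNeg p {{nonNegative 0≤p}} q {{nonNegative 0≤q}}}}

p≤q⇒0≤q-p : ∀ {p q} → p ≤ q → 0ℚ ≤ q - p
p≤q⇒0≤q-p {p} {q} p≤q = subst (_≤ q - p) (ℚ.+-inverseʳ p) (ℚ.+-monoˡ-≤ (- p) p≤q)

private
  variable
    A B : Set

sumℚ-cong : ∀ (xs : List A) {f g : A → ℚ} → (∀ x → f x ≡ g x) → sumℚ xs f ≡ sumℚ xs g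
sumℚ-cong []       f≗g = refl
sumℚ-cong (x ∷ xs) f≗g = cong₂ _+_ (f≗g x) (sumℚ-cong xs f≗g)

sumℚ-congᴬ : ∀ {xs : List A} {f g : A → ℚ} → All (λ x → f x ≡ g x) xs → sumℚ xs f ≡ sumℚ xs g
sumℚ-congᴬ []         = refl
sumℚ-congᴬ (px ∷ pxs) = cong₂ _+_ px (sumℚ-congᴬ pxs)

sumℚ-monoᴬ : ∀ {xs : List A} {f g : A → ℚ} → All (λ x → f x ≤ g x) xs → sumℚ xs f ≤ sumℚ xs g
sumℚ-monoᴬ []         = ℚ.≤-refl
sumℚ-monoᴬ (px ∷ pxs) = ℚ.+-mono-≤ px (sumℚ-monoᴬ pxs)

sumℚ-mono : ∀ (xs : List A) {f g : A → ℚ} → (∀ x → f x ≤ g x) → sumℚ xs f ≤ sumℚ xs g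
sumℚ-mono []       f≤g = ℚ.≤-refl
sumℚ-mono (x ∷ xs) f≤g = ℚ.+-mono-≤ (f≤g x) (sumℚ-mono xs f≤g)

sumℚ-nonneg : ∀ (xs : List A) {f : A → ℚ} → (∀ x → 0ℚ ≤ f x) → 0ℚ ≤ sumℚ xs f
sumℚ-nonneg []       0≤f = ℚ.≤-refl
sumℚ-nonneg (x ∷ xs) 0≤f = ℚ.+-mono-≤ (0≤f x) (sumℚ-nonneg xs 0≤f)

sumℚ-0 : ∀ (xs : List A) → sumℚ xs (λ _ → 0ℚ) ≡ 0ℚ
sumℚ-0 []       = refl
sumℚ-0 (x ∷ xs) = cong (0ℚ +_) (sumℚ-0 xs)

sumℚ-0* : ∀ (xs : List A) (f : A → ℚ) → sumℚ xs (λ x → 0ℚ * f x) ≡ 0ℚ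
sumℚ-0* xs f = trans (sumℚ-cong xs (λ x → ℚ.*-zeroˡ (f x))) (sumℚ-0 xs)

sumℚ-+ : ∀ (xs : List A) (f g : A → ℚ) → sumℚ xs (λ x → f x + g x) ≡ sumℚ xs f + sumℚ xs g
sumℚ-+ []       f g = refl
sumℚ-+ (x ∷ xs) f g = trans (cong (f x + g x +_) (sumℚ-+ xs f g))
  (solve 4 (λ a b c d → (a :+ b) :+ (c :+ d) := (a :+ c) :+ (b :+ d)) refl (f x) (g x) (sumℚ xs f) (sumℚ xs g))

sumℚ-*ˡ : ∀ (xs : List A) (k : ℚ) (f : A → ℚ) → sumℚ xs (λ x → k * f x) ≡ k * sumℚ xs f
sumℚ-*ˡ []       k f = sym (ℚ.*-zeroʳ k)
sumℚ-*ˡ (x ∷ xs) k f = trans (cong (k * f x +_) (sumℚ-*ˡ xs k f)) (sym (ℚ.*-distribˡ-+ k (f x) (sumℚ xs f)))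

sumℚ-*ʳ : ∀ (xs : List A) (k : ℚ) (f : A → ℚ) → sumℚ xs (λ x → f x * k) ≡ sumℚ xs f * k
sumℚ-*ʳ xs k f = trans (sumℚ-cong xs (λ x → ℚ.*-comm (f x) k)) (trans (sumℚ-*ˡ xs k f) (ℚ.*-comm k (sumℚ xs f)))

sumℚ-neg : ∀ (xs : List A) (f : A → ℚ) → sumℚ xs (λ x → - f x) ≡ - sumℚ xs f
sumℚ-neg []       f = refl
sumℚ-neg (x ∷ xs) f = trans (cong (- f x +_) (sumℚ-neg xs f)) (sym (ℚ.neg-distrib-+ (f x) (sumℚ xs f)))

sumℚ-diff : ∀ (xs : List A) (f g : A → ℚ) → sumℚ xs (λ x → f x - g x) ≡ sumℚ xs f - sumℚ xs g
sumℚ-diff xs f g = trans (sumℚ-+ xs f (λ x → - g x)) (cong (sumℚ xs f +_) (sumℚ-neg xs g))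

sumℚ-const : ∀ (xs : List A) (k : ℚ) → sumℚ xs (λ _ → k) ≡ sumℚ xs (λ _ → 1ℚ) * k
sumℚ-const xs k = trans (sumℚ-cong xs (λ _ → sym (ℚ.*-identityʳ k)))
  (trans (sumℚ-*ˡ xs k (λ _ → 1ℚ)) (ℚ.*-comm k _))

sumℚ-++ : ∀ (xs ys : List A) (f : A → ℚ) → sumℚ (xs ++ ys) f ≡ sumℚ xs f + sumℚ ys f
sumℚ-++ []       ys f = sym (ℚ.+-identityˡ _)
sumℚ-++ (x ∷ xs) ys f = trans (cong (f x +_) (sumℚ-++ xs ys f)) (sym (ℚ.+-assoc (f x) _ _))

sumℚ-filterB : ∀ (p : A → Bool) (xs : List A) (f : A → ℚ) →
  sumℚ (filterB p xs) f ≡ sumℚ xs (λ x → 𝟙 (p x) * f x)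
sumℚ-filterB p []       f = refl
sumℚ-filterB p (x ∷ xs) f with p x
... | true  = cong₂ _+_ (sym (ℚ.*-identityˡ (f x))) (sumℚ-filterB p xs f)
... | false = trans (sumℚ-filterB p xs f)
  (sym (trans (cong (_+ sumℚ xs (λ y → 𝟙 (p y) * f y)) (ℚ.*-zeroˡ (f x))) (ℚ.+-identityˡ _)))

sumℚ-≤-member : ∀ {xs : List A} {x} (f : A → ℚ) → (∀ y → 0ℚ ≤ f y) → x ∈ₗ xs → f x ≤ sumℚ xs f
sumℚ-≤-member {xs = y ∷ ys} f 0≤f (here refl) =
  subst (_≤ f y + sumℚ ys f) (ℚ.+-identityʳ (f y)) (ℚ.+-monoʳ-≤ (f y) (sumℚ-nonneg ys 0≤f))
sumℚ-≤-member {xs = y ∷ ys} f 0≤f (there x∈ys) =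
  subst (_≤ f y + sumℚ ys f) (ℚ.+-identityˡ _) (ℚ.+-mono-≤ (0≤f y) (sumℚ-≤-member f 0≤f x∈ys))

sumℚ-concatMap : ∀ (h : A → List B) (xs : List A) (f : B → ℚ) →
  sumℚ (concatMap h xs) f ≡ sumℚ xs (λ x → sumℚ (h x) f)
sumℚ-concatMap h []       f = refl
sumℚ-concatMap h (x ∷ xs) f =
  trans (sumℚ-++ (h x) (concatMap h xs) f) (cong (sumℚ (h x) f +_) (sumℚ-concatMap h xs f))

sumℚ-swap : ∀ (xs : List A) (ys : List B) (f : A → B → ℚ) →
  sumℚ xs (λ x → sumℚ ys (f x)) ≡ sumℚ ys (λ y → sumℚ xs (λ x → f x y))
sumℚ-swap []       ys f = sym (sumℚ-0 ys)
sumℚ-swap (x ∷ xs) ys f = trans (cong (sumℚ ys (f x) +_) (sumℚ-swap xs ys f))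
  (sym (sumℚ-+ ys (f x) (λ y → sumℚ xs (λ x′ → f x′ y))))

sumℚ-tabulate : ∀ {n} (f : Fin n → A) (h : A → ℚ) →
  sumℚ (tabulate f) h ≡ sumℚ (allFin n) (λ i → h (f i))
sumℚ-tabulate {n = zero}  f h = refl
sumℚ-tabulate {n = suc n} f h = cong (h (f zero) +_)
  (trans (sumℚ-tabulate (λ i → f (suc i)) h) (sym (sumℚ-tabulate Fin.suc (λ i → h (f i)))))

eqFin⇒≡ : ∀ {n} {i j : Fin n} → eqFin i j ≡ true → i ≡ j
eqFin⇒≡ {i = zero}  {zero}  _ = refl
eqFin⇒≡ {i = suc i} {suc j} p = cong suc (eqFin⇒≡ p)

eqFin-refl : ∀ {n} (i : Fin n) → eqFin i i ≡ true
eqFin-refl zero    = refl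
eqFin-refl (suc i) = eqFin-refl i

eqFin-sym : ∀ {n} (i j : Fin n) → eqFin i j ≡ eqFin j i
eqFin-sym zero    zero    = refl
eqFin-sym zero    (suc j) = refl
eqFin-sym (suc i) zero    = refl
eqFin-sym (suc i) (suc j) = eqFin-sym i j

sumℚ-allFin-eqFin : ∀ {n} (i : Fin n) (g : Fin n → ℚ) → sumℚ (allFin n) (λ a → 𝟙 (eqFin i a) * g a) ≡ g i
sumℚ-allFin-eqFin {suc n} zero g = begin
    1ℚ * g zero + sumℚ (tabulate (Fin.suc {n})) (λ a → 𝟙 (eqFin zero a) * g a)
  ≡⟨ cong (1ℚ * g zero +_) (sumℚ-tabulate (Fin.suc {n}) (λ a → 𝟙 (eqFin zero a) * g a)) ⟩
    1ℚ * g zero + sumℚ (allFin n) (λ a → 0ℚ * g (suc a))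
  ≡⟨ cong (1ℚ * g zero +_) (sumℚ-0* (allFin n) (λ a → g (suc a))) ⟩
    1ℚ * g zero + 0ℚ
  ≡⟨ trans (ℚ.+-identityʳ _) (ℚ.*-identityˡ _) ⟩
    g zero ∎
  where open ≡-Reasoning
sumℚ-allFin-eqFin {suc n} (suc i) g = begin
    0ℚ * g zero + sumℚ (tabulate (Fin.suc {n})) (λ a → 𝟙 (eqFin (suc i) a) * g a)
  ≡⟨ trans (cong (_+ rest) (ℚ.*-zeroˡ (g zero))) (ℚ.+-identityˡ rest) ⟩
    rest
  ≡⟨ sumℚ-tabulate (Fin.suc {n}) (λ a → 𝟙 (eqFin (suc i) a) * g a) ⟩
    sumℚ (allFin n) (λ a → 𝟙 (eqFin i a) * g (suc a))
  ≡⟨ sumℚ-allFin-eqFin i (λ a → g (suc a)) ⟩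
    g (suc i) ∎
  where
  open ≡-Reasoning
  rest = sumℚ (tabulate (Fin.suc {n})) (λ a → 𝟙 (eqFin (suc i) a) * g a)

Subset-ext : ∀ {n} {X Y : Subset n} → (∀ j → lookup X j ≡ lookup Y j) → X ≡ Y
Subset-ext {X = X} {Y} X≗Y = trans (sym (tabulate∘lookup X)) (trans (tabulate-cong X≗Y) (tabulate∘lookup Y))

lookup-⊕ : ∀ {n} (X Y : Subset n) j → lookup (X ⊕ Y) j ≡ lookup X j xor lookup Y j
lookup-⊕ X Y j = lookup-zipWith _xor_ j X Y

lookup-∪ : ∀ {n} (X Y : Subset n) j → lookup (X ∪ Y) j ≡ lookup X j ∨ lookup Y j
lookup-∪ X Y j = lookup-zipWith _∨_ j X Y

lookup-∁ : ∀ {n} (X : Subset n) j → lookup (∁ X) j ≡ not (lookup X j)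
lookup-∁ X j = lookup-map j not X

lookup-⊥ : ∀ {n} (j : Fin n) → lookup ⊥ j ≡ false
lookup-⊥ j = lookup-replicate j false

lookup-⊤ : ∀ {n} (j : Fin n) → lookup ⊤ j ≡ true
lookup-⊤ j = lookup-replicate j true

lookup-⁅⁆ : ∀ {n} (i j : Fin n) → lookup ⁅ i ⁆ j ≡ eqFin i j
lookup-⁅⁆ zero    zero    = refl
lookup-⁅⁆ zero    (suc j) = lookup-⊥ j
lookup-⁅⁆ (suc i) zero    = refl
lookup-⁅⁆ (suc i) (suc j) = lookup-⁅⁆ i j

lookup-⁅i⁆-i : ∀ {n} (i : Fin n) → lookup ⁅ i ⁆ i ≡ true
lookup-⁅i⁆-i i = trans (lookup-⁅⁆ i i) (eqFin-refl i)

lookup-∪⁅i⁆-i : ∀ {n} (X : Subset n) i → lookup (X ∪ ⁅ i ⁆) i ≡ true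
lookup-∪⁅i⁆-i X i = trans (lookup-∪ X ⁅ i ⁆ i) (trans (cong (lookup X i ∨_) (lookup-⁅i⁆-i i)) (∨-zeroʳ _))

lookup-⊕⁅i⁆-i : ∀ {n} (X : Subset n) i → lookup (X ⊕ ⁅ i ⁆) i ≡ not (lookup X i)
lookup-⊕⁅i⁆-i X i = trans (lookup-⊕ X ⁅ i ⁆ i)
  (trans (cong (lookup X i xor_) (lookup-⁅i⁆-i i)) (trans (xor-comm (lookup X i) true) (true-xor (lookup X i))))

lookup-⊕⁅i⁆-j : ∀ {n} (X : Subset n) {i j} → eqFin i j ≡ false → lookup (X ⊕ ⁅ i ⁆) j ≡ lookup X j
lookup-⊕⁅i⁆-j X {i} {j} i≢j = trans (lookup-⊕ X ⁅ i ⁆ j)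
  (trans (cong (lookup X j xor_) (trans (lookup-⁅⁆ i j) i≢j)) (xor-identityʳ (lookup X j)))

eqSub⇒≡ : ∀ {n} {X Y : Subset n} → eqSub X Y ≡ true → X ≡ Y
eqSub⇒≡ {X = []}         {[]}         _ = refl
eqSub⇒≡ {X = true ∷ X}  {true ∷ Y}  p = cong (true ∷_) (eqSub⇒≡ p)
eqSub⇒≡ {X = false ∷ X} {false ∷ Y} p = cong (false ∷_) (eqSub⇒≡ p)

eqSub-refl : ∀ {n} (X : Subset n) → eqSub X X ≡ true
eqSub-refl []          = refl
eqSub-refl (true ∷ X)  = eqSub-refl X
eqSub-refl (false ∷ X) = eqSub-refl X

eqSub-sym : ∀ {n} (X Y : Subset n) → eqSub X Y ≡ eqSub Y X
eqSub-sym []          []          = refl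
eqSub-sym (true ∷ X)  (true ∷ Y)  = eqSub-sym X Y
eqSub-sym (false ∷ X) (false ∷ Y) = eqSub-sym X Y
eqSub-sym (true ∷ X)  (false ∷ Y) = refl
eqSub-sym (false ∷ X) (true ∷ Y)  = refl

≢⇒eqSub≡false : ∀ {n} {X Y : Subset n} → X ≢ Y → eqSub X Y ≡ false
≢⇒eqSub≡false {X = X} {Y} X≢Y with eqSub X Y in eq
... | true  = contradiction (eqSub⇒≡ eq) X≢Y
... | false = refl

e≡𝟙eqSub : ∀ {n} (X Y : Subset n) → e X Y ≡ 𝟙 (eqSub X Y)
e≡𝟙eqSub X Y with eqSub X Y
... | true  = refl
... | false = refl

e-sym : ∀ {n} (X Y : Subset n) → e X Y ≡ e Y X
e-sym X Y = trans (e≡𝟙eqSub X Y) (trans (cong 𝟙 (eqSub-sym X Y)) (sym (e≡𝟙eqSub Y X)))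

⊕-assoc : ∀ {n} (X Y Z : Subset n) → (X ⊕ Y) ⊕ Z ≡ X ⊕ (Y ⊕ Z)
⊕-assoc = zipWith-assoc xor-assoc

⊕-comm : ∀ {n} (X Y : Subset n) → X ⊕ Y ≡ Y ⊕ X
⊕-comm = zipWith-comm xor-comm

⊕-identityʳ : ∀ {n} (X : Subset n) → X ⊕ ⊥ ≡ X
⊕-identityʳ = zipWith-identityʳ xor-identityʳ

⊕-identityˡ : ∀ {n} (X : Subset n) → ⊥ ⊕ X ≡ X
⊕-identityˡ X = trans (⊕-comm ⊥ X) (⊕-identityʳ X)

⊕-swapʳ : ∀ {n} (X Y Z : Subset n) → (X ⊕ Y) ⊕ Z ≡ (X ⊕ Z) ⊕ Y
⊕-swapʳ X Y Z = trans (⊕-assoc X Y Z) (trans (cong (X ⊕_) (⊕-comm Y Z)) (sym (⊕-assoc X Z Y)))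

⊕-self : ∀ {n} (X : Subset n) → X ⊕ X ≡ ⊥
⊕-self []      = refl
⊕-self (x ∷ X) = cong₂ _∷_ (xor-same x) (⊕-self X)

⊕-cancelʳ : ∀ {n} (X Y : Subset n) → (X ⊕ Y) ⊕ Y ≡ X
⊕-cancelʳ X Y = trans (⊕-assoc X Y Y) (trans (cong (X ⊕_) (⊕-self Y)) (⊕-identityʳ X))

∁≡⊕⊤ : ∀ {n} (X : Subset n) → ∁ X ≡ X ⊕ ⊤
∁≡⊕⊤ []          = refl
∁≡⊕⊤ (true ∷ X)  = cong (false ∷_) (∁≡⊕⊤ X)
∁≡⊕⊤ (false ∷ X) = cong (true ∷_) (∁≡⊕⊤ X)

sumℚ-allSubsets-split : ∀ n (h : Subset (suc n) → ℚ) →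
  sumℚ (allSubsets (suc n)) h ≡ sumℚ (allSubsets n) (λ X → h (true ∷ X)) + sumℚ (allSubsets n) (λ X → h (false ∷ X))
sumℚ-allSubsets-split n h = begin
    sumℚ (allSubsets (suc n)) h
  ≡⟨ sumℚ-concatMap (λ X → (true ∷ X) ∷ (false ∷ X) ∷ []) (allSubsets n) h ⟩
    sumℚ (allSubsets n) (λ X → h (true ∷ X) + (h (false ∷ X) + 0ℚ))
  ≡⟨ sumℚ-cong (allSubsets n) (λ X → cong (h (true ∷ X) +_) (ℚ.+-identityʳ (h (false ∷ X)))) ⟩
    sumℚ (allSubsets n) (λ X → h (true ∷ X) + h (false ∷ X))
  ≡⟨ sumℚ-+ (allSubsets n) (λ X → h (true ∷ X)) (λ X → h (false ∷ X)) ⟩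
    sumℚ (allSubsets n) (λ X → h (true ∷ X)) + sumℚ (allSubsets n) (λ X → h (false ∷ X)) ∎
  where open ≡-Reasoning

sumℚ-allSubsets-e : ∀ {n} (C : Subset n) (g : Subset n → ℚ) → sumℚ (allSubsets n) (λ X → e X C * g X) ≡ g C
sumℚ-allSubsets-e {zero}  []          g = trans (ℚ.+-identityʳ _) (ℚ.*-identityˡ (g []))
sumℚ-allSubsets-e {suc n} (true ∷ C)  g = begin
    sumℚ (allSubsets (suc n)) (λ X → e X (true ∷ C) * g X)
  ≡⟨ sumℚ-allSubsets-split n (λ X → e X (true ∷ C) * g X) ⟩
    sumℚ (allSubsets n) (λ X → e X C * g (true ∷ X)) + sumℚ (allSubsets n) (λ X → 0ℚ * g (false ∷ X))
  ≡⟨ cong₂ _+_ (sumℚ-allSubsets-e C (λ X → g (true ∷ X))) (sumℚ-0* (allSubsets n) (λ X → g (false ∷ X))) ⟩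
    g (true ∷ C) + 0ℚ
  ≡⟨ ℚ.+-identityʳ _ ⟩
    g (true ∷ C) ∎
  where open ≡-Reasoning
sumℚ-allSubsets-e {suc n} (false ∷ C) g = begin
    sumℚ (allSubsets (suc n)) (λ X → e X (false ∷ C) * g X)
  ≡⟨ sumℚ-allSubsets-split n (λ X → e X (false ∷ C) * g X) ⟩
    sumℚ (allSubsets n) (λ X → 0ℚ * g (true ∷ X)) + sumℚ (allSubsets n) (λ X → e X C * g (false ∷ X))
  ≡⟨ cong₂ _+_ (sumℚ-0* (allSubsets n) (λ X → g (true ∷ X))) (sumℚ-allSubsets-e C (λ X → g (false ∷ X))) ⟩
    0ℚ + g (false ∷ C)
  ≡⟨ ℚ.+-identityˡ _ ⟩
    g (false ∷ C) ∎
  where open ≡-Reasoning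

sumℚ-allSubsets-e′ : ∀ {n} (C : Subset n) (g : Subset n → ℚ) → sumℚ (allSubsets n) (λ X → e C X * g X) ≡ g C
sumℚ-allSubsets-e′ C g =
  trans (sumℚ-cong (allSubsets _) (λ X → cong (_* g X) (e-sym C X))) (sumℚ-allSubsets-e C g)

sumℚ-allSubsets-⊕ : ∀ {n} (R : Subset n) (h : Subset n → ℚ) →
  sumℚ (allSubsets n) h ≡ sumℚ (allSubsets n) (λ X → h (X ⊕ R))
sumℚ-allSubsets-⊕ {zero}  []      h = refl
sumℚ-allSubsets-⊕ {suc n} (r ∷ R) h = begin
    sumℚ (allSubsets (suc n)) h
  ≡⟨ sumℚ-allSubsets-split n h ⟩
    sumℚ (allSubsets n) (λ X → h (true ∷ X)) + sumℚ (allSubsets n) (λ X → h (false ∷ X))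
  ≡⟨ cong₂ _+_ (sumℚ-allSubsets-⊕ R (λ X → h (true ∷ X))) (sumℚ-allSubsets-⊕ R (λ X → h (false ∷ X))) ⟩
    u true + u false
  ≡⟨ flip-first r ⟩
    u (true xor r) + u (false xor r)
  ≡⟨ sym (sumℚ-allSubsets-split n (λ X → h (X ⊕ (r ∷ R)))) ⟩
    sumℚ (allSubsets (suc n)) (λ X → h (X ⊕ (r ∷ R))) ∎
  where
  open ≡-Reasoning
  u : Bool → ℚ
  u b = sumℚ (allSubsets n) (λ X → h (b ∷ (X ⊕ R)))
  flip-first : ∀ r → u true + u false ≡ u (true xor r) + u (false xor r)
  flip-first false = refl
  flip-first true  = ℚ.+-comm (u true) (u false)

sumℚ-allSubsets-∁ : ∀ {n} (h : Subset n → ℚ) → sumℚ (allSubsets n) h ≡ sumℚ (allSubsets n) (λ X → h (∁ X))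
sumℚ-allSubsets-∁ h =
  trans (sumℚ-allSubsets-⊕ ⊤ h) (sumℚ-cong (allSubsets _) (λ X → cong h (sym (∁≡⊕⊤ X))))

-- Paths along permutations

Δe : ∀ {n} → Subset n → Subset n → Subset n → ℚ
Δe A B C = e B C - e A C

pathEnd : ∀ {n} → Subset n → List (Fin n) → Subset n
pathEnd X []       = X
pathEnd X (i ∷ is) = pathEnd (X ⊕ ⁅ i ⁆) is

stepΔe : ∀ {n} → Subset n → Pair (Subset n) → ℚ
stepΔe C ⟨ U , V ⟩ = Δe U V C

sumℚ-steps-stepΔe : ∀ {n} (C X : Subset n) σ → sumℚ (steps X σ) (stepΔe C) ≡ Δe X (pathEnd X σ) C
sumℚ-steps-stepΔe C X []       = sym (ℚ.+-inverseʳ (e X C))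
sumℚ-steps-stepΔe C X (i ∷ is) = trans (cong (Δe X (X ⊕ ⁅ i ⁆) C +_) (sumℚ-steps-stepΔe C (X ⊕ ⁅ i ⁆) is))
  (solve 3 (λ a b c → (b :- a) :+ (c :- b) := c :- a) refl (e X C) (e (X ⊕ ⁅ i ⁆) C) (e (pathEnd (X ⊕ ⁅ i ⁆) is) C))

lookup-pathEnd-∉ : ∀ {n} (X : Subset n) σ {j} → elemB j σ ≡ false → lookup (pathEnd X σ) j ≡ lookup X j
lookup-pathEnd-∉ X []       _   = refl
lookup-pathEnd-∉ X (i ∷ is) {j} j∉σ with eqFin j i in j≢i
... | false = trans (lookup-pathEnd-∉ (X ⊕ ⁅ i ⁆) is j∉σ) (lookup-⊕⁅i⁆-j X (trans (eqFin-sym i j) j≢i))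

lookup-pathEnd-∈ : ∀ {n} (X : Subset n) σ {j} → noDup σ ≡ true → elemB j σ ≡ true →
  lookup (pathEnd X σ) j ≡ not (lookup X j)
lookup-pathEnd-∈ X (i ∷ is) {j} nd j∈σ with eqFin j i in j≟i | elemB i is in i∉is
... | true  | false with refl ← eqFin⇒≡ {i = j} {i} j≟i =
  trans (lookup-pathEnd-∉ (X ⊕ ⁅ j ⁆) is i∉is) (lookup-⊕⁅i⁆-i X j)
... | false | false =
  trans (lookup-pathEnd-∈ (X ⊕ ⁅ i ⁆) is nd j∈σ) (cong not (lookup-⊕⁅i⁆-j X (trans (eqFin-sym i j) j≟i)))

elements : ∀ {n} → List (Fin n) → Subset n
elements []       = ⊥
elements (i ∷ is) = ⁅ i ⁆ ∪ elements is

lookup-elements : ∀ {n} (σ : List (Fin n)) j → lookup (elements σ) j ≡ elemB j σ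
lookup-elements []       j = lookup-⊥ j
lookup-elements (i ∷ is) j =
  trans (lookup-∪ ⁅ i ⁆ (elements is) j) (cong₂ _∨_ (trans (lookup-⁅⁆ i j) (eqFin-sym i j)) (lookup-elements is j))

∣⁅i⁆∪p∣ : ∀ {n} (i : Fin n) (p : Subset n) → lookup p i ≡ false → ∣ ⁅ i ⁆ ∪ p ∣ ≡ suc ∣ p ∣
∣⁅i⁆∪p∣ zero    (false ∷ p) _   = cong (λ q → suc ∣ q ∣) (∪-identityˡ p)
∣⁅i⁆∪p∣ (suc i) (true ∷ p)  i∉p = cong suc (∣⁅i⁆∪p∣ i p i∉p)
∣⁅i⁆∪p∣ (suc i) (false ∷ p) i∉p = ∣⁅i⁆∪p∣ i p i∉p

∣elements∣ : ∀ {n} (σ : List (Fin n)) → noDup σ ≡ true → ∣ elements σ ∣ ≡ length σ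
∣elements∣ {n} [] _ = ∣⊥∣ n
  where
  ∣⊥∣ : ∀ m → ∣ ⊥ {m} ∣ ≡ 0
  ∣⊥∣ zero    = refl
  ∣⊥∣ (suc m) = ∣⊥∣ m
∣elements∣ (i ∷ is) nd with elemB i is in i∉is | noDup is in nd′
... | false | true = trans (∣⁅i⁆∪p∣ i (elements is) (trans (lookup-elements is i) i∉is)) (cong suc (∣elements∣ is nd′))

noDup-full⇒elemB : ∀ {n} (σ : List (Fin n)) j → noDup σ ≡ true → length σ ≡ n → elemB j σ ≡ true
noDup-full⇒elemB σ j nd |σ|≡n = begin
    elemB j σ
  ≡⟨ lookup-elements σ j ⟨
    lookup (elements σ) j
  ≡⟨ cong (λ p → lookup p j) (∣p∣≡n⇒p≡⊤ {p = elements σ} (trans (∣elements∣ σ nd) |σ|≡n)) ⟩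
    lookup ⊤ j
  ≡⟨ lookup-⊤ j ⟩
    true ∎
  where open ≡-Reasoning

pathEnd-perm : ∀ {n} (X : Subset n) σ → length σ ≡ n → noDup σ ≡ true → pathEnd X σ ≡ ∁ X
pathEnd-perm X σ |σ|≡n nd = Subset-ext (λ j →
  trans (lookup-pathEnd-∈ X σ nd (noDup-full⇒elemB σ j nd |σ|≡n)) (sym (lookup-∁ X j)))

All-filterB : ∀ {P : A → Set} (p : A → Bool) {xs : List A} → All P xs → All (λ x → P x × p x ≡ true) (filterB p xs)
All-filterB p []                 = []
All-filterB p {x ∷ _} (px ∷ pxs) with p x in eq
... | true  = (px , eq) ∷ All-filterB p pxs
... | false = All-filterB p pxs

seqs-length : ∀ n k → All (λ σ → length σ ≡ k) (seqs n k)
seqs-length n zero    = refl ∷ []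
seqs-length n (suc k) =
  concat⁺ (map⁺ (All.map (λ |s|≡k → map⁺ (universal (λ _ → cong suc |s|≡k) (allFin n))) (seqs-length n k)))

perms-valid : ∀ n → All (λ σ → length σ ≡ n × noDup σ ≡ true) (perms n)
perms-valid n = All-filterB noDup (seqs-length n n)

∈-seqs : ∀ n k (σ : List (Fin n)) → length σ ≡ k → σ ∈ₗ seqs n k
∈-seqs n zero    []      refl = here refl
∈-seqs n (suc k) (i ∷ s) refl =
  ∈-concatMap⁺ (λ s → map (λ j → j ∷ s) (allFin n)) (lose (∈-seqs n k s refl) (∈-map⁺ (λ j → j ∷ s) (∈-allFin i)))

elemB-zero-map-suc : ∀ {n} (xs : List (Fin n)) → elemB zero (map suc xs) ≡ false
elemB-zero-map-suc []       = refl
elemB-zero-map-suc (x ∷ xs) = elemB-zero-map-suc xs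

elemB-suc-map-suc : ∀ {n} (i : Fin n) (xs : List (Fin n)) → elemB (suc i) (map suc xs) ≡ elemB i xs
elemB-suc-map-suc i []       = refl
elemB-suc-map-suc i (x ∷ xs) = cong (eqFin i x ∨_) (elemB-suc-map-suc i xs)

noDup-map-suc : ∀ {n} (xs : List (Fin n)) → noDup (map suc xs) ≡ noDup xs
noDup-map-suc []       = refl
noDup-map-suc (x ∷ xs) = cong₂ (λ b c → not b ∧ c) (elemB-suc-map-suc x xs) (noDup-map-suc xs)

noDup-allFin : ∀ n → noDup (allFin n) ≡ true
noDup-allFin zero    = refl
noDup-allFin (suc n) rewrite sym (map-tabulate (λ i → i) (Fin.suc {n}))
                           | elemB-zero-map-suc (allFin n) | noDup-map-suc (allFin n) = noDup-allFin n

#perms : ℕ → ℚ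
#perms n = sumℚ (perms n) (λ _ → 1ℚ)

1≤#perms : ∀ n → 1ℚ ≤ #perms n
1≤#perms n = begin
    1ℚ
  ≡⟨ cong (λ b → 𝟙 b * 1ℚ) (noDup-allFin n) ⟨
    𝟙 (noDup (allFin n)) * 1ℚ
  ≤⟨ sumℚ-≤-member (λ σ → 𝟙 (noDup σ) * 1ℚ) (λ σ → 0≤*0≤⇒0≤* (0≤𝟙 (noDup σ)) (0≤𝟙 true))
       (∈-seqs n n (allFin n) (length-tabulate (λ i → i))) ⟩
    sumℚ (seqs n n) (λ σ → 𝟙 (noDup σ) * 1ℚ)
  ≡⟨ sumℚ-filterB noDup (seqs n n) (λ _ → 1ℚ) ⟨
    #perms n ∎
  where open ℚ.≤-Reasoning

-- Λ as a sum over steps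

fromℤ-+ : ∀ x y → fromℤ (x ℤ.+ y) ≡ fromℤ x + fromℤ y
fromℤ-+ x y = ℚ.toℚᵘ-injective (ℚᵘ.≃-trans unnormalised (ℚᵘ.≃-sym (ℚ.toℚᵘ-homo-+ (fromℤ x) (fromℤ y))))
  where
  open ℤ-Solver.+-*-Solver renaming (solve to solveℤ; _:+_ to _⊕ℤ_; _:*_ to _⊗ℤ_; _:=_ to _≐_; con to conℤ)
  unnormalised : ℚᵘ.mkℚᵘ (x ℤ.+ y) 0 ℚᵘ.≃ (toℚᵘ (fromℤ x) ℚᵘ.+ toℚᵘ (fromℤ y))
  unnormalised = ℚᵘ.*≡* (solveℤ 2 (λ x y → (x ⊕ℤ y) ⊗ℤ conℤ (ℤ.+ 1)
                                         ≐ (x ⊗ℤ conℤ (ℤ.+ 1) ⊕ℤ y ⊗ℤ conℤ (ℤ.+ 1)) ⊗ℤ conℤ (ℤ.+ 1)) refl x y)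

fromℤ-neg : ∀ x → fromℤ (ℤ.- x) ≡ - fromℤ x
fromℤ-neg (ℤ.+ 0)       = refl
fromℤ-neg (ℤ.+ (suc n)) = refl
fromℤ-neg ℤ.-[1+ n ]    = refl

fromℤ-diff : ∀ x y → fromℤ (x ℤ.- y) ≡ fromℤ x - fromℤ y
fromℤ-diff x y = trans (fromℤ-+ x (ℤ.- y)) (cong (fromℤ x +_) (fromℤ-neg y))

fromℤ-mono-≤ : ∀ {x y} → x ℤ.≤ y → fromℤ x ≤ fromℤ y
fromℤ-mono-≤ {x} {y} x≤y = *≤* (subst₂ ℤ._≤_ (sym (ℤ.*-identityʳ x)) (sym (ℤ.*-identityʳ y)) x≤y)

fromℤ-countB : ∀ (p : A → Bool) xs → fromℤ (ℤ.+ countB p xs) ≡ sumℚ xs (λ x → 𝟙 (p x))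
fromℤ-countB p []       = refl
fromℤ-countB p (x ∷ xs) with p x
... | true  = trans (fromℤ-+ (ℤ.+ 1) (ℤ.+ countB p xs)) (cong (1ℚ +_) (fromℤ-countB p xs))
... | false = trans (fromℤ-countB p xs) (sym (ℚ.+-identityˡ _))

fromℤ-countB-diff : ∀ (p q : A → Bool) xs {h : A → ℚ} → (∀ x → 𝟙 (p x) - 𝟙 (q x) ≡ h x) →
  fromℤ (ℤ.+ countB p xs ℤ.- ℤ.+ countB q xs) ≡ sumℚ xs h
fromℤ-countB-diff p q xs {h} p-q≗h = begin
    fromℤ (ℤ.+ countB p xs ℤ.- ℤ.+ countB q xs)
  ≡⟨ fromℤ-diff (ℤ.+ countB p xs) (ℤ.+ countB q xs) ⟩
    fromℤ (ℤ.+ countB p xs) - fromℤ (ℤ.+ countB q xs)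
  ≡⟨ cong₂ _-_ (fromℤ-countB p xs) (fromℤ-countB q xs) ⟩
    sumℚ xs (λ x → 𝟙 (p x)) - sumℚ xs (λ x → 𝟙 (q x))
  ≡⟨ sumℚ-diff xs (λ x → 𝟙 (p x)) (λ x → 𝟙 (q x)) ⟨
    sumℚ xs (λ x → 𝟙 (p x) - 𝟙 (q x))
  ≡⟨ sumℚ-cong xs p-q≗h ⟩
    sumℚ xs h ∎
  where open ≡-Reasoning

Λℚ : ∀ {n} → Family n → Subset n → Subset n → ℚ
Λℚ G Y Z = fromℤ (Λ G Y Z)

traversal : ∀ {n} → Subset n → Subset n → Pair (Subset n) → ℚ
traversal Y Z ⟨ U , V ⟩ = 𝟙 (eqSub U Y ∧ eqSub V Z) - 𝟙 (eqSub V Y ∧ eqSub U Z)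

Λℚ≡sumℚ-traversal : ∀ {n} (G : Family n) Y Z → Λℚ G Y Z ≡ sumℚ (allSteps G) (traversal Y Z)
Λℚ≡sumℚ-traversal G Y Z =
  fromℤ-countB-diff _ _ (allSteps G) {traversal Y Z} (λ { ⟨ U , V ⟩ → refl })

absent : ∀ {n} → Subset n → Fin n → ℚ
absent A a = 𝟙 (not (lookup A a))

sumUp : ∀ {n} → (Fin n → Subset n → ℚ) → ℚ
sumUp {n} f = sumℚ (allFin n) (λ a → sumℚ (allSubsets n) (λ A → absent A a * f a A))

sumℚ-sumUp : ∀ {n} (xs : List A) (f : A → Fin n → Subset n → ℚ) →
  sumℚ xs (λ x → sumUp (f x)) ≡ sumUp (λ a A → sumℚ xs (λ x → f x a A))
sumℚ-sumUp {n = n} xs f = begin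
    sumℚ xs (λ x → sumℚ (allFin n) (λ a → sumℚ (allSubsets n) (λ A → absent A a * f x a A)))
  ≡⟨ sumℚ-swap xs (allFin n) (λ x a → sumℚ (allSubsets n) (λ A → absent A a * f x a A)) ⟩
    sumℚ (allFin n) (λ a → sumℚ xs (λ x → sumℚ (allSubsets n) (λ A → absent A a * f x a A)))
  ≡⟨ sumℚ-cong (allFin n) (λ a → sumℚ-swap xs (allSubsets n) (λ x A → absent A a * f x a A)) ⟩
    sumℚ (allFin n) (λ a → sumℚ (allSubsets n) (λ A → sumℚ xs (λ x → absent A a * f x a A)))
  ≡⟨ sumℚ-cong (allFin n) (λ a → sumℚ-cong (allSubsets n) (λ A → sumℚ-*ˡ xs (absent A a) (λ x → f x a A))) ⟩
    sumUp (λ a A → sumℚ xs (λ x → f x a A)) ∎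
  where open ≡-Reasoning

sumUp-cong : ∀ {n} {f g : Fin n → Subset n → ℚ} → (∀ a A → f a A ≡ g a A) → sumUp f ≡ sumUp g
sumUp-cong {n} f≗g = sumℚ-cong (allFin n) (λ a → sumℚ-cong (allSubsets n) (λ A → cong (absent A a *_) (f≗g a A)))

sumUp-diff : ∀ {n} (f g : Fin n → Subset n → ℚ) → sumUp (λ a A → f a A - g a A) ≡ sumUp f - sumUp g
sumUp-diff {n} f g = begin
    sumUp (λ a A → f a A - g a A)
  ≡⟨ sumℚ-cong (allFin n) (λ a → trans (sumℚ-cong (allSubsets n) (λ A →
       solve 3 (λ x p q → x :* (p :- q) := x :* p :- x :* q) refl (absent A a) (f a A) (g a A)))
       (sumℚ-diff (allSubsets n) (λ A → absent A a * f a A) (λ A → absent A a * g a A))) ⟩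
    sumℚ (allFin n) (λ a → sumℚ (allSubsets n) (λ A → absent A a * f a A) - sumℚ (allSubsets n) (λ A → absent A a * g a A))
  ≡⟨ sumℚ-diff (allFin n) (λ a → sumℚ (allSubsets n) (λ A → absent A a * f a A))
                      (λ a → sumℚ (allSubsets n) (λ A → absent A a * g a A)) ⟩
    sumUp f - sumUp g ∎
  where open ≡-Reasoning

sumUp-*ˡ : ∀ {n} (c : Fin n → ℚ) (f : Fin n → Subset n → ℚ) →
  sumUp (λ a A → c a * f a A) ≡ sumℚ (allFin n) (λ a → c a * sumℚ (allSubsets n) (λ A → absent A a * f a A))
sumUp-*ˡ {n} c f = sumℚ-cong (allFin n) (λ a → trans
  (sumℚ-cong (allSubsets n) (λ A → solve 3 (λ x k p → x :* (k :* p) := k :* (x :* p)) refl (absent A a) (c a) (f a A)))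
  (sumℚ-*ˡ (allSubsets n) (c a) (λ A → absent A a * f a A)))

-- Steps as signed up-edges

flip≡add : ∀ {n} (U : Subset n) (i a : Fin n) →
  not (lookup U a) ∧ eqSub (U ⊕ ⁅ i ⁆) (U ∪ ⁅ a ⁆) ≡ not (lookup U i) ∧ eqFin i a
flip≡add (true  ∷ U) zero    zero    = refl
flip≡add (false ∷ U) zero    zero    = subst (λ X → eqSub X (U ∪ ⊥) ≡ true) (sym (⊕-identityʳ U))
                                         (subst (λ X → eqSub U X ≡ true) (sym (∪-identityʳ U)) (eqSub-refl U))
flip≡add (true  ∷ U) zero    (suc a) = ∧-zeroʳ _
flip≡add (false ∷ U) zero    (suc a) = ∧-zeroʳ _
flip≡add (true  ∷ U) (suc i) zero    = sym (∧-zeroʳ _)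
flip≡add (false ∷ U) (suc i) zero    = sym (∧-zeroʳ _)
flip≡add (true  ∷ U) (suc i) (suc a) = flip≡add U i a
flip≡add (false ∷ U) (suc i) (suc a) = flip≡add U i a

sumℚ-flip≡add : ∀ {n} (U : Subset n) i (g : Fin n → ℚ) →
  sumℚ (allFin n) (λ a → absent U a * 𝟙 (eqSub (U ⊕ ⁅ i ⁆) (U ∪ ⁅ a ⁆)) * g a) ≡ absent U i * g i
sumℚ-flip≡add {n} U i g = begin
    sumℚ (allFin n) (λ a → absent U a * 𝟙 (eqSub (U ⊕ ⁅ i ⁆) (U ∪ ⁅ a ⁆)) * g a)
  ≡⟨ sumℚ-cong (allFin n) (λ a → cong (_* g a) (sym (𝟙-∧ (not (lookup U a)) _))) ⟩
    sumℚ (allFin n) (λ a → 𝟙 (not (lookup U a) ∧ eqSub (U ⊕ ⁅ i ⁆) (U ∪ ⁅ a ⁆)) * g a)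
  ≡⟨ sumℚ-cong (allFin n) (λ a → cong (λ b → 𝟙 b * g a) (flip≡add U i a)) ⟩
    sumℚ (allFin n) (λ a → 𝟙 (not (lookup U i) ∧ eqFin i a) * g a)
  ≡⟨ sumℚ-cong (allFin n) (λ a → trans (cong (_* g a) (𝟙-∧ (not (lookup U i)) (eqFin i a)))
       (solve 3 (λ x y z → (x :* y) :* z := y :* (x :* z)) refl (absent U i) (𝟙 (eqFin i a)) (g a))) ⟩
    sumℚ (allFin n) (λ a → 𝟙 (eqFin i a) * (absent U i * g a))
  ≡⟨ sumℚ-allFin-eqFin i (λ a → absent U i * g a) ⟩
    absent U i * g i ∎
  where open ≡-Reasoning

∪⁅i⁆≡⊕⁅i⁆ : ∀ {n} (U : Subset n) i → lookup U i ≡ false → U ∪ ⁅ i ⁆ ≡ U ⊕ ⁅ i ⁆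
∪⁅i⁆≡⊕⁅i⁆ U i i∉U = Subset-ext λ j → begin
    lookup (U ∪ ⁅ i ⁆) j            ≡⟨ lookup-∪ U ⁅ i ⁆ j ⟩
    lookup U j ∨ lookup ⁅ i ⁆ j     ≡⟨ pointwise j ⟩
    lookup U j xor lookup ⁅ i ⁆ j   ≡⟨ lookup-⊕ U ⁅ i ⁆ j ⟨
    lookup (U ⊕ ⁅ i ⁆) j            ∎
  where
  open ≡-Reasoning
  pointwise : ∀ j → lookup U j ∨ lookup ⁅ i ⁆ j ≡ lookup U j xor lookup ⁅ i ⁆ j
  pointwise j rewrite lookup-⁅⁆ i j with eqFin i j in i≟j
  ... | true with refl ← eqFin⇒≡ {i = i} {j} i≟j rewrite i∉U = refl
  ... | false with lookup U j
  ...   | true  = refl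
  ...   | false = refl

⊕⁅i⁆∪⁅i⁆ : ∀ {n} (U : Subset n) i → lookup U i ≡ true → (U ⊕ ⁅ i ⁆) ∪ ⁅ i ⁆ ≡ U
⊕⁅i⁆∪⁅i⁆ U i i∈U = Subset-ext λ j → begin
    lookup ((U ⊕ ⁅ i ⁆) ∪ ⁅ i ⁆) j                    ≡⟨ lookup-∪ (U ⊕ ⁅ i ⁆) ⁅ i ⁆ j ⟩
    lookup (U ⊕ ⁅ i ⁆) j ∨ lookup ⁅ i ⁆ j             ≡⟨ cong (_∨ lookup ⁅ i ⁆ j) (lookup-⊕ U ⁅ i ⁆ j) ⟩
    (lookup U j xor lookup ⁅ i ⁆ j) ∨ lookup ⁅ i ⁆ j  ≡⟨ pointwise j ⟩
    lookup U j                                         ∎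
  where
  open ≡-Reasoning
  pointwise : ∀ j → (lookup U j xor lookup ⁅ i ⁆ j) ∨ lookup ⁅ i ⁆ j ≡ lookup U j
  pointwise j rewrite lookup-⁅⁆ i j with eqFin i j in i≟j
  ... | true with refl ← eqFin⇒≡ {i = i} {j} i≟j rewrite i∈U = refl
  ... | false with lookup U j
  ...   | true  = refl
  ...   | false = refl

Δe-flip : ∀ {n} (U : Subset n) i C →
  Δe U (U ⊕ ⁅ i ⁆) C ≡ absent U i * Δe U (U ∪ ⁅ i ⁆) C - absent (U ⊕ ⁅ i ⁆) i * Δe (U ⊕ ⁅ i ⁆) ((U ⊕ ⁅ i ⁆) ∪ ⁅ i ⁆) C
Δe-flip U i C rewrite lookup-⊕⁅i⁆-i U i with lookup U i in U∋i
... | false rewrite ∪⁅i⁆≡⊕⁅i⁆ U i U∋i =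
  solve 3 (λ v u w → v :- u := con 1ℚ :* (v :- u) :- con 0ℚ :* w) refl
    (e (U ⊕ ⁅ i ⁆) C) (e U C) (Δe (U ⊕ ⁅ i ⁆) ((U ⊕ ⁅ i ⁆) ∪ ⁅ i ⁆) C)
... | true  rewrite ⊕⁅i⁆∪⁅i⁆ U i U∋i =
  solve 3 (λ v u w → v :- u := con 0ℚ :* w :- con 1ℚ :* (u :- v)) refl (e (U ⊕ ⁅ i ⁆) C) (e U C) (Δe U (U ∪ ⁅ i ⁆) C)

upExpansion : ∀ {n} → Subset n → Pair (Subset n) → ℚ
upExpansion C s = sumUp (λ a A → traversal A (A ∪ ⁅ a ⁆) s * Δe A (A ∪ ⁅ a ⁆) C)

-- The step ⟨U, U ⊕ {i}⟩ can only traverse the up-edge with a = i at A = U or at A = U ⊕ {i},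
-- and exactly one of these is an up-edge.
stepΔe≡upExpansion : ∀ {n} (U : Subset n) i C → stepΔe C ⟨ U , U ⊕ ⁅ i ⁆ ⟩ ≡ upExpansion C ⟨ U , U ⊕ ⁅ i ⁆ ⟩
stepΔe≡upExpansion {n} U i C = sym (begin
    upExpansion C ⟨ U , V ⟩
  ≡⟨ sumℚ-cong (allFin n) (λ a → sumℚ-cong (allSubsets n) (split a)) ⟩
    sumℚ (allFin n) (λ a → sumℚ (allSubsets n) (λ A → from U V a A - from V U a A))
  ≡⟨ sumℚ-cong (allFin n) (λ a → sumℚ-diff (allSubsets n) (from U V a) (from V U a)) ⟩
    sumℚ (allFin n) (λ a → sumℚ (allSubsets n) (from U V a) - sumℚ (allSubsets n) (from V U a))
  ≡⟨ sumℚ-cong (allFin n) (λ a → cong₂ _-_ (sumℚ-allSubsets-e′ U (edge V a)) (sumℚ-allSubsets-e′ V (edge U a))) ⟩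
    sumℚ (allFin n) (λ a → edge V a U - edge U a V)
  ≡⟨ sumℚ-diff (allFin n) (λ a → edge V a U) (λ a → edge U a V) ⟩
    sumℚ (allFin n) (λ a → edge V a U) - sumℚ (allFin n) (λ a → edge U a V)
  ≡⟨ cong₂ _-_ (sumℚ-flip≡add U i (λ a → Δe U (U ∪ ⁅ a ⁆) C))
               (trans (sumℚ-cong (allFin n) (λ a → cong (λ X → edge X a V) (sym (⊕-cancelʳ U ⁅ i ⁆))))
                      (sumℚ-flip≡add V i (λ a → Δe V (V ∪ ⁅ a ⁆) C))) ⟩
    absent U i * Δe U (U ∪ ⁅ i ⁆) C - absent V i * Δe V (V ∪ ⁅ i ⁆) C
  ≡⟨ Δe-flip U i C ⟨
    Δe U V C ∎)
  where
  open ≡-Reasoning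
  V = U ⊕ ⁅ i ⁆
  edge : Subset n → Fin n → Subset n → ℚ
  edge Y a A = absent A a * 𝟙 (eqSub Y (A ∪ ⁅ a ⁆)) * Δe A (A ∪ ⁅ a ⁆) C
  from : Subset n → Subset n → Fin n → Subset n → ℚ
  from X Y a A = e X A * edge Y a A
  split : ∀ a A → absent A a * (traversal A (A ∪ ⁅ a ⁆) ⟨ U , V ⟩ * Δe A (A ∪ ⁅ a ⁆) C) ≡ from U V a A - from V U a A
  split a A rewrite 𝟙-∧ (eqSub U A) (eqSub V (A ∪ ⁅ a ⁆)) | 𝟙-∧ (eqSub V A) (eqSub U (A ∪ ⁅ a ⁆))
                  | e≡𝟙eqSub U A | e≡𝟙eqSub V A =
    solve 6 (λ m p q p′ q′ w → m :* ((p :* q :- p′ :* q′) :* w) := p :* (m :* q :* w) :- p′ :* (m :* q′ :* w)) refl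
      (absent A a) (𝟙 (eqSub U A)) (𝟙 (eqSub V (A ∪ ⁅ a ⁆))) (𝟙 (eqSub V A)) (𝟙 (eqSub U (A ∪ ⁅ a ⁆))) (Δe A (A ∪ ⁅ a ⁆) C)

All-steps : ∀ {n} {P : Pair (Subset n) → Set} → (∀ U i → P ⟨ U , U ⊕ ⁅ i ⁆ ⟩) → ∀ X σ → All P (steps X σ)
All-steps P-step X []       = []
All-steps P-step X (i ∷ is) = P-step X i ∷ All-steps P-step (X ⊕ ⁅ i ⁆) is

All-allSteps : ∀ {n} {P : Pair (Subset n) → Set} → (∀ U i → P ⟨ U , U ⊕ ⁅ i ⁆ ⟩) → ∀ G → All P (allSteps G)
All-allSteps {n} P-step G =
  concat⁺ (map⁺ (universal (λ σ → concat⁺ (map⁺ (universal (λ X → All-steps P-step X σ) (filterB G (allSubsets n)))))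
                           (perms n)))

sumℚ-allSteps-expansion : ∀ {n} (G : Family n) C →
  sumℚ (allSteps G) (stepΔe C) ≡ sumUp (λ a A → Λℚ G A (A ∪ ⁅ a ⁆) * Δe A (A ∪ ⁅ a ⁆) C)
sumℚ-allSteps-expansion G C = begin
    sumℚ (allSteps G) (stepΔe C)
  ≡⟨ sumℚ-congᴬ (All-allSteps {P = λ s → stepΔe C s ≡ upExpansion C s} (λ U i → stepΔe≡upExpansion U i C) G) ⟩
    sumℚ (allSteps G) (upExpansion C)
  ≡⟨ sumℚ-sumUp (allSteps G) (λ s a A → traversal A (A ∪ ⁅ a ⁆) s * Δe A (A ∪ ⁅ a ⁆) C) ⟩
    sumUp (λ a A → sumℚ (allSteps G) (λ s → traversal A (A ∪ ⁅ a ⁆) s * Δe A (A ∪ ⁅ a ⁆) C))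
  ≡⟨ sumUp-cong (λ a A → trans (sumℚ-*ʳ (allSteps G) (Δe A (A ∪ ⁅ a ⁆) C) (traversal A (A ∪ ⁅ a ⁆)))
                                (cong (_* Δe A (A ∪ ⁅ a ⁆) C) (sym (Λℚ≡sumℚ-traversal G A (A ∪ ⁅ a ⁆))))) ⟩
    sumUp (λ a A → Λℚ G A (A ∪ ⁅ a ⁆) * Δe A (A ∪ ⁅ a ⁆) C) ∎
  where open ≡-Reasoning

sumℚ-allSteps : ∀ {n} (G : Family n) (f : Pair (Subset n) → ℚ) →
  sumℚ (allSteps G) f ≡ sumℚ (perms n) (λ σ → sumℚ (filterB G (allSubsets n)) (λ X → sumℚ (steps X σ) f))
sumℚ-allSteps {n} G f = trans (sumℚ-concatMap paths (perms n) f)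
  (sumℚ-cong (perms n) (λ σ → sumℚ-concatMap (λ X → steps X σ) (filterB G (allSubsets n)) f))
  where paths = λ σ → concatMap (λ X → steps X σ) (filterB G (allSubsets n))

sumℚ-allSteps-stepΔe : ∀ {n} (G : Family n) C →
  sumℚ (allSteps G) (stepΔe C) ≡ #perms n * sumℚ (filterB G (allSubsets n)) (λ X → Δe X (∁ X) C)
sumℚ-allSteps-stepΔe {n} G C = begin
    sumℚ (allSteps G) (stepΔe C)
  ≡⟨ sumℚ-allSteps G (stepΔe C) ⟩
    sumℚ (perms n) (λ σ → sumℚ starts (λ X → sumℚ (steps X σ) (stepΔe C)))
  ≡⟨ sumℚ-congᴬ (All.map (λ {σ} (|σ|≡n , nd) → along σ |σ|≡n nd) (perms-valid n)) ⟩
    sumℚ (perms n) (λ _ → opposite)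
  ≡⟨ sumℚ-const (perms n) opposite ⟩
    #perms n * opposite ∎
  where
  open ≡-Reasoning
  starts = filterB G (allSubsets n)
  opposite = sumℚ starts (λ X → Δe X (∁ X) C)
  along : ∀ σ → length σ ≡ n → noDup σ ≡ true → sumℚ starts (λ X → sumℚ (steps X σ) (stepΔe C)) ≡ opposite
  along σ |σ|≡n nd =
    sumℚ-cong starts (λ X → trans (sumℚ-steps-stepΔe C X σ) (cong (λ Y → Δe X Y C) (pathEnd-perm X σ |σ|≡n nd)))

bar≡𝟙-𝟙 : ∀ {n} (F : Family n) C → bar F C ≡ 𝟙 (F C) - 𝟙 (F (∁ C))
bar≡𝟙-𝟙 F C with F C | F (∁ C)
... | true  | true  = refl
... | true  | false = refl
... | false | true  = refl
... | false | false = refl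

sumℚ-star-Δe-∁ : ∀ {n} (F : Family n) C → sumℚ (filterB (star F) (allSubsets n)) (λ X → Δe X (∁ X) C) ≡ bar F C
sumℚ-star-Δe-∁ {n} F C = begin
    sumℚ (filterB (star F) (allSubsets n)) (λ X → Δe X (∁ X) C)
  ≡⟨ sumℚ-filterB (star F) (allSubsets n) (λ X → Δe X (∁ X) C) ⟩
    sumℚ (allSubsets n) (λ X → 𝟙 (F (∁ X)) * (e (∁ X) C - e X C))
  ≡⟨ sumℚ-cong (allSubsets n) (λ X →
       solve 3 (λ f a b → f :* (a :- b) := a :* f :- b :* f) refl (𝟙 (F (∁ X))) (e (∁ X) C) (e X C)) ⟩
    sumℚ (allSubsets n) (λ X → e (∁ X) C * 𝟙 (F (∁ X)) - e X C * 𝟙 (F (∁ X)))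
  ≡⟨ sumℚ-diff (allSubsets n) (λ X → e (∁ X) C * 𝟙 (F (∁ X))) (λ X → e X C * 𝟙 (F (∁ X))) ⟩
    sumℚ (allSubsets n) (λ X → e (∁ X) C * 𝟙 (F (∁ X))) - sumℚ (allSubsets n) (λ X → e X C * 𝟙 (F (∁ X)))
  ≡⟨ cong₂ _-_ (trans (sym (sumℚ-allSubsets-∁ (λ Y → e Y C * 𝟙 (F Y)))) (sumℚ-allSubsets-e C (λ Y → 𝟙 (F Y))))
               (sumℚ-allSubsets-e C (λ X → 𝟙 (F (∁ X)))) ⟩
    𝟙 (F C) - 𝟙 (F (∁ C))
  ≡⟨ bar≡𝟙-𝟙 F C ⟨
    bar F C ∎
  where open ≡-Reasoning

Λ-identity : ∀ {n} (F : Family n) C →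
  #perms n * bar F C ≡ sumUp (λ a A → Λℚ (star F) A (A ∪ ⁅ a ⁆) * Δe A (A ∪ ⁅ a ⁆) C)
Λ-identity {n} F C = begin
    #perms n * bar F C
  ≡⟨ cong (#perms n *_) (sumℚ-star-Δe-∁ F C) ⟨
    #perms n * sumℚ (filterB (star F) (allSubsets n)) (λ X → Δe X (∁ X) C)
  ≡⟨ sumℚ-allSteps-stepΔe (star F) C ⟨
    sumℚ (allSteps (star F)) (stepΔe C)
  ≡⟨ sumℚ-allSteps-expansion (star F) C ⟩
    sumUp (λ a A → Λℚ (star F) A (A ∪ ⁅ a ⁆) * Δe A (A ∪ ⁅ a ⁆) C) ∎
  where open ≡-Reasoning

-- Maximal intersecting families

separated-at : ∀ {n} {X Y : Subset n} j → lookup X j ≡ false → lookup Y j ≡ true → X ≢ Y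
separated-at j j∉X j∈Y refl with () ← trans (sym j∉X) j∈Y

member⇒eqSub⊥≡false : ∀ {n} (Y : Subset n) j → lookup Y j ≡ true → eqSub Y ⊥ ≡ false
member⇒eqSub⊥≡false Y j j∈Y = ≢⇒eqSub≡false {X = Y} (λ Y≡⊥ → separated-at j (lookup-⊥ j) j∈Y (sym Y≡⊥))

intersecting⇒⊥∉ : ∀ {n} {F : Family n} → Intersecting F → F ⊥ ≡ false
intersecting⇒⊥∉ {F = F} intersecting with F ⊥ in ⊥∈F
... | false = refl
... | true  = contradiction (proj₁ (x∈p∩q⁻ ⊥ ⊥ (proj₂ (intersecting ⊥ ⊥ ⊥∈F ⊥∈F)))) ∉⊥

module _ {n} {F : Family n} (maximalIntersecting : MaximalIntersecting F) where

  private
    intersecting = proj₁ maximalIntersecting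
    maximal      = proj₂ maximalIntersecting

  maximal-extend : ∀ B → (∀ X → F X ≡ true → Nonempty (X ∩ B)) → Nonempty (B ∩ B) → F B ≡ true
  maximal-extend B meets B∩B≢∅ =
    maximal F+B intersecting-F+B (λ A A∈F → cong (_∨ eqSub A B) A∈F) B (trans (cong (F B ∨_) (eqSub-refl B)) (∨-zeroʳ (F B)))
    where
    F+B : Family n
    F+B X = F X ∨ eqSub X B
    intersecting-F+B : Intersecting F+B
    intersecting-F+B X Y X∈ Y∈ with F X in X∈F | F Y in Y∈F
    ... | true  | true  = intersecting X Y X∈F Y∈F
    ... | true  | false with refl ← eqSub⇒≡ {X = Y} Y∈ = meets X X∈F
    ... | false | true  with refl ← eqSub⇒≡ {X = X} X∈ = subst Nonempty (∩-comm Y X) (meets Y Y∈F)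
    ... | false | false with refl ← eqSub⇒≡ {X = X} X∈ | refl ← eqSub⇒≡ {X = Y} Y∈ = B∩B≢∅

  maximal-upward : ∀ {A B} → F A ≡ true → A ⊆ B → F B ≡ true
  maximal-upward {A} {B} A∈F A⊆B = maximal-extend B meets B∩B≢∅
    where
    meets : ∀ X → F X ≡ true → Nonempty (X ∩ B)
    meets X X∈F with j , j∈X∩A ← intersecting X A X∈F A∈F =
      j , x∈p∩q⁺ (proj₁ (x∈p∩q⁻ X A j∈X∩A) , A⊆B (proj₂ (x∈p∩q⁻ X A j∈X∩A)))
    B∩B≢∅ : Nonempty (B ∩ B)
    B∩B≢∅ with j , j∈A∩A ← intersecting A A A∈F A∈F =
      j , x∈p∩q⁺ (A⊆B (proj₁ (x∈p∩q⁻ A A j∈A∩A)) , A⊆B (proj₁ (x∈p∩q⁻ A A j∈A∩A)))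

  maximal-⊤ : n ≥ 1 → F ⊤ ≡ true
  maximal-⊤ (s≤s z≤n) = maximal-extend ⊤ meets (zero , x∈p∩q⁺ (∈⊤ , ∈⊤))
    where
    meets : ∀ X → F X ≡ true → Nonempty (X ∩ ⊤)
    meets X X∈F with j , j∈X∩X ← intersecting X X X∈F X∈F = j , x∈p∩q⁺ (proj₁ (x∈p∩q⁻ X X j∈X∩X) , ∈⊤)

  bar-⊥ : n ≥ 1 → bar F ⊥ ≡ - 1ℚ
  bar-⊥ n≥1 = trans (bar≡𝟙-𝟙 F ⊥)
    (cong₂ (λ x y → 𝟙 x - 𝟙 y) (intersecting⇒⊥∉ intersecting) (trans (cong F ∁⊥≡⊤) (maximal-⊤ n≥1)))
    where
    ∁⊥≡⊤ : ∀ {m} → ∁ (⊥ {m}) ≡ ⊤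
    ∁⊥≡⊤ {zero}  = refl
    ∁⊥≡⊤ {suc m} = cong (true ∷_) ∁⊥≡⊤

DownClosed : ∀ {n} → Family n → Set
DownClosed {n} G = ∀ {X Y : Subset n} → G X ≡ true → Y ⊆ X → G Y ≡ true

star-downClosed : ∀ {n} {F : Family n} → MaximalIntersecting F → DownClosed (star F)
star-downClosed maximalIntersecting ∁X∈F Y⊆X = maximal-upward maximalIntersecting ∁X∈F (p⊆q⇒∁p⊇∁q Y⊆X)

-- Traversals of the edge (∅, {a})

eqSub-⊕ : ∀ {n} (U R Q : Subset n) → eqSub (U ⊕ R) Q ≡ eqSub U (Q ⊕ R)
eqSub-⊕ []      []      []      = refl
eqSub-⊕ (u ∷ U) (r ∷ R) (q ∷ Q) = cong₂ _∧_ (eqB-xor u r q) (eqSub-⊕ U R Q)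
  where
  eqB-xor : ∀ u r q → eqB (u xor r) q ≡ eqB u (q xor r)
  eqB-xor true  true  true  = refl
  eqB-xor true  true  false = refl
  eqB-xor true  false true  = refl
  eqB-xor true  false false = refl
  eqB-xor false true  true  = refl
  eqB-xor false true  false = refl
  eqB-xor false false true  = refl
  eqB-xor false false false = refl

shift : ∀ {n} → Subset n → Pair (Subset n) → Pair (Subset n)
shift R ⟨ U , V ⟩ = ⟨ U ⊕ R , V ⊕ R ⟩

sumℚ-steps-⊕ : ∀ {n} (X R : Subset n) σ (f : Pair (Subset n) → ℚ) →
  sumℚ (steps (X ⊕ R) σ) f ≡ sumℚ (steps X σ) (λ s → f (shift R s))
sumℚ-steps-⊕ X R []       f = refl
sumℚ-steps-⊕ X R (i ∷ is) f rewrite ⊕-swapʳ X R ⁅ i ⁆ =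
  cong (f ⟨ X ⊕ R , (X ⊕ ⁅ i ⁆) ⊕ R ⟩ +_) (sumℚ-steps-⊕ (X ⊕ ⁅ i ⁆) R is f)

module _ {n} (a : Fin n) where

  forward backward : Pair (Subset n) → ℚ
  forward  ⟨ U , V ⟩ = 𝟙 (eqSub U ⊥ ∧ eqSub V ⁅ a ⁆)
  backward ⟨ U , V ⟩ = 𝟙 (eqSub V ⊥ ∧ eqSub U ⁅ a ⁆)

  -- Translating by {a} swaps ∅ and {a}, turning backward traversals into forward ones.
  sumℚ-steps-backward : ∀ X σ → sumℚ (steps X σ) backward ≡ sumℚ (steps (X ⊕ ⁅ a ⁆) σ) forward
  sumℚ-steps-backward X σ = trans (sumℚ-cong (steps X σ) backward≡forward∘shift) (sym (sumℚ-steps-⊕ X ⁅ a ⁆ σ forward))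
    where
    backward≡forward∘shift : ∀ s → backward s ≡ forward (shift ⁅ a ⁆ s)
    backward≡forward∘shift ⟨ U , V ⟩ = cong 𝟙 (trans (∧-comm (eqSub V ⊥) (eqSub U ⁅ a ⁆))
      (sym (cong₂ _∧_ (trans (eqSub-⊕ U ⁅ a ⁆ ⊥) (cong (eqSub U) (⊕-identityˡ ⁅ a ⁆)))
                      (trans (eqSub-⊕ V ⁅ a ⁆ ⁅ a ⁆) (cong (eqSub V) (⊕-self ⁅ a ⁆))))))

  sumℚ-steps-forward-∉ : ∀ Y σ → lookup Y a ≡ false → elemB a σ ≡ false → sumℚ (steps Y σ) forward ≡ 0ℚ
  sumℚ-steps-forward-∉ Y []       _   _   = refl
  sumℚ-steps-forward-∉ Y (i ∷ is) a∉Y a∉σ with eqFin a i in a≢i | elemB a is in a∉is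
  ... | false | false =
    cong₂ _+_ (cong 𝟙 (trans (cong (eqSub Y ⊥ ∧_) Y⊕i≢⁅a⁆) (∧-zeroʳ (eqSub Y ⊥))))
              (sumℚ-steps-forward-∉ (Y ⊕ ⁅ i ⁆) is a∉Y⊕i a∉is)
    where
    a∉Y⊕i : lookup (Y ⊕ ⁅ i ⁆) a ≡ false
    a∉Y⊕i = trans (lookup-⊕⁅i⁆-j Y (trans (eqFin-sym i a) a≢i)) a∉Y
    Y⊕i≢⁅a⁆ : eqSub (Y ⊕ ⁅ i ⁆) ⁅ a ⁆ ≡ false
    Y⊕i≢⁅a⁆ = ≢⇒eqSub≡false {X = Y ⊕ ⁅ i ⁆} (separated-at a a∉Y⊕i (lookup-⁅i⁆-i a))

  -- A path through a permutation flips a only once, so from a set containing a it never enters {a} from ∅.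
  sumℚ-steps-forward-∈ : ∀ Y σ → lookup Y a ≡ true → noDup σ ≡ true → sumℚ (steps Y σ) forward ≡ 0ℚ
  sumℚ-steps-forward-∈ Y []       _   _  = refl
  sumℚ-steps-forward-∈ Y (i ∷ is) a∈Y nd with eqFin i a in i≟a | elemB i is in i∉is | noDup is in nd′
  ... | true  | false | true with refl ← eqFin⇒≡ {i = i} {a} i≟a =
    cong₂ _+_ (cong 𝟙 (cong (_∧ eqSub (Y ⊕ ⁅ a ⁆) ⁅ a ⁆) (member⇒eqSub⊥≡false Y a a∈Y)))
              (sumℚ-steps-forward-∉ (Y ⊕ ⁅ a ⁆) is (trans (lookup-⊕⁅i⁆-i Y a) (cong not a∈Y)) i∉is)
  ... | false | false | true =
    cong₂ _+_ (cong 𝟙 (cong (_∧ eqSub (Y ⊕ ⁅ i ⁆) ⁅ a ⁆) (member⇒eqSub⊥≡false Y a a∈Y)))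
              (sumℚ-steps-forward-∈ (Y ⊕ ⁅ i ⁆) is (trans (lookup-⊕⁅i⁆-j Y i≟a) a∈Y) nd′)

  0≤forward : ∀ s → 0ℚ ≤ forward s
  0≤forward ⟨ U , V ⟩ = 0≤𝟙 (eqSub U ⊥ ∧ eqSub V ⁅ a ⁆)

  -- A backward traversal from X is a forward one from Y = X ⊕ {a}; that needs a ∉ Y, so Y ⊆ X and Y ∈ G.
  sumℚ-paths-backward≤forward : ∀ {G : Family n} → DownClosed G → ∀ σ → noDup σ ≡ true →
    sumℚ (filterB G (allSubsets n)) (λ X → sumℚ (steps X σ) backward)
      ≤ sumℚ (filterB G (allSubsets n)) (λ X → sumℚ (steps X σ) forward)
  sumℚ-paths-backward≤forward {G} downClosed σ nd = begin
      sumℚ (filterB G (allSubsets n)) (λ X → sumℚ (steps X σ) backward)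
    ≡⟨ sumℚ-filterB G (allSubsets n) (λ X → sumℚ (steps X σ) backward) ⟩
      sumℚ (allSubsets n) (λ X → 𝟙 (G X) * sumℚ (steps X σ) backward)
    ≡⟨ sumℚ-cong (allSubsets n) (λ X → cong₂ (λ Y t → 𝟙 (G Y) * t) (sym (⊕-cancelʳ X ⁅ a ⁆)) (sumℚ-steps-backward X σ)) ⟩
      sumℚ (allSubsets n) (λ X → shifted (X ⊕ ⁅ a ⁆))
    ≡⟨ sumℚ-allSubsets-⊕ ⁅ a ⁆ shifted ⟨
      sumℚ (allSubsets n) shifted
    ≤⟨ sumℚ-mono (allSubsets n) shifted≤unshifted ⟩
      sumℚ (allSubsets n) (λ Y → 𝟙 (G Y) * sumℚ (steps Y σ) forward)
    ≡⟨ sumℚ-filterB G (allSubsets n) (λ Y → sumℚ (steps Y σ) forward) ⟨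
      sumℚ (filterB G (allSubsets n)) (λ Y → sumℚ (steps Y σ) forward) ∎
    where
    open ℚ.≤-Reasoning
    shifted : Subset n → ℚ
    shifted Y = 𝟙 (G (Y ⊕ ⁅ a ⁆)) * sumℚ (steps Y σ) forward
    shifted≤unshifted : ∀ Y → shifted Y ≤ 𝟙 (G Y) * sumℚ (steps Y σ) forward
    shifted≤unshifted Y with lookup Y a in a∈?Y
    ... | true rewrite sumℚ-steps-forward-∈ Y σ a∈?Y nd =
      ℚ.≤-reflexive (trans (ℚ.*-zeroʳ (𝟙 (G (Y ⊕ ⁅ a ⁆)))) (sym (ℚ.*-zeroʳ (𝟙 (G Y)))))
    ... | false with G (Y ⊕ ⁅ a ⁆) in Y+a∈G
    ...   | true rewrite downClosed Y+a∈G (subst (Y ⊆_) (∪⁅i⁆≡⊕⁅i⁆ Y a a∈?Y) (p⊆p∪q ⁅ a ⁆)) = ℚ.≤-refl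
    ...   | false = subst (_≤ 𝟙 (G Y) * sumℚ (steps Y σ) forward) (sym (ℚ.*-zeroˡ (sumℚ (steps Y σ) forward)))
                      (0≤*0≤⇒0≤* (0≤𝟙 (G Y)) (sumℚ-nonneg (steps Y σ) 0≤forward))

  0≤Λℚ-⊥-⁅⁆ : ∀ {G : Family n} → DownClosed G → 0ℚ ≤ Λℚ G ⊥ ⁅ a ⁆
  0≤Λℚ-⊥-⁅⁆ {G} downClosed = subst (0ℚ ≤_) (sym Λℚ≡forward-backward) (p≤q⇒0≤q-p backward≤forward)
    where
    Λℚ≡forward-backward : Λℚ G ⊥ ⁅ a ⁆ ≡ sumℚ (allSteps G) forward - sumℚ (allSteps G) backward
    Λℚ≡forward-backward = trans (Λℚ≡sumℚ-traversal G ⊥ ⁅ a ⁆)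
      (trans (sumℚ-cong (allSteps G) {traversal ⊥ ⁅ a ⁆} {λ s → forward s - backward s} (λ { ⟨ U , V ⟩ → refl }))
             (sumℚ-diff (allSteps G) forward backward))
    backward≤forward : sumℚ (allSteps G) backward ≤ sumℚ (allSteps G) forward
    backward≤forward = subst₂ _≤_ (sym (sumℚ-allSteps G backward)) (sym (sumℚ-allSteps G forward))
      (sumℚ-monoᴬ (All.map (λ {σ} (_ , nd) → sumℚ-paths-backward≤forward downClosed σ nd) (perms-valid n)))

sumUp-Δe-⊥ : ∀ {n} (f : Fin n → Subset n → ℚ) → sumUp (λ a A → f a A * Δe A (A ∪ ⁅ a ⁆) ⊥) ≡ - sumℚ (allFin n) (λ a → f a ⊥)
sumUp-Δe-⊥ {n} f = begin
    sumUp (λ a A → f a A * Δe A (A ∪ ⁅ a ⁆) ⊥)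
  ≡⟨ sumℚ-cong (allFin n) (λ a → sumℚ-cong (allSubsets n) (λ A → pointwise a A)) ⟩
    sumℚ (allFin n) (λ a → sumℚ (allSubsets n) (λ A → - (e A ⊥ * (absent A a * f a A))))
  ≡⟨ sumℚ-cong (allFin n) (λ a → trans (sumℚ-neg (allSubsets n) (λ A → e A ⊥ * (absent A a * f a A)))
       (cong -_ (trans (sumℚ-allSubsets-e ⊥ (λ A → absent A a * f a A))
                       (trans (cong (λ b → 𝟙 (not b) * f a ⊥) (lookup-⊥ a)) (ℚ.*-identityˡ (f a ⊥)))))) ⟩
    sumℚ (allFin n) (λ a → - f a ⊥)
  ≡⟨ sumℚ-neg (allFin n) (λ a → f a ⊥) ⟩
    - sumℚ (allFin n) (λ a → f a ⊥) ∎
  where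
  open ≡-Reasoning
  ⊥≢A∪a : ∀ A a → e (A ∪ ⁅ a ⁆) ⊥ ≡ 0ℚ
  ⊥≢A∪a A a = trans (e≡𝟙eqSub (A ∪ ⁅ a ⁆) ⊥) (cong 𝟙 (member⇒eqSub⊥≡false (A ∪ ⁅ a ⁆) a (lookup-∪⁅i⁆-i A a)))
  pointwise : ∀ a A → absent A a * (f a A * Δe A (A ∪ ⁅ a ⁆) ⊥) ≡ - (e A ⊥ * (absent A a * f a A))
  pointwise a A rewrite ⊥≢A∪a A a =
    solve 3 (λ x p q → x :* (p :* (con 0ℚ :- q)) := :- (q :* (x :* p))) refl (absent A a) (f a A) (e A ⊥)

bar-S-fam : ∀ {n} (a : Fin n) C → sumℚ (allSubsets n) (λ A → absent A a * Δe A (A ∪ ⁅ a ⁆) C) ≡ bar (S-fam a) C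
bar-S-fam {n} a C = begin
    sumℚ (allSubsets n) (λ A → absent A a * Δe A (A ∪ ⁅ a ⁆) C)
  ≡⟨ sumℚ-cong (allSubsets n) (λ A → trans
       (solve 3 (λ x p q → x :* (p :- q) := x :* p :- x :* q) refl (absent A a) (e (A ∪ ⁅ a ⁆) C) (e A C))
       (trans (cong (_- absent A a * e A C) (add≡flip A))
              (solve 3 (λ x p q → x :* p :- x :* q := p :* x :- q :* x) refl (absent A a) (e (A ⊕ ⁅ a ⁆) C) (e A C)))) ⟩
    sumℚ (allSubsets n) (λ A → e (A ⊕ ⁅ a ⁆) C * absent A a - e A C * absent A a)
  ≡⟨ sumℚ-diff (allSubsets n) (λ A → e (A ⊕ ⁅ a ⁆) C * absent A a) (λ A → e A C * absent A a) ⟩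
    sumℚ (allSubsets n) (λ A → e (A ⊕ ⁅ a ⁆) C * absent A a) - sumℚ (allSubsets n) (λ A → e A C * absent A a)
  ≡⟨ cong₂ _-_ flipped (sumℚ-allSubsets-e C (λ A → absent A a)) ⟩
    𝟙 (lookup C a) - 𝟙 (not (lookup C a))
  ≡⟨ cong (λ b → 𝟙 (lookup C a) - 𝟙 b) (lookup-∁ C a) ⟨
    𝟙 (lookup C a) - 𝟙 (lookup (∁ C) a)
  ≡⟨ bar≡𝟙-𝟙 (S-fam a) C ⟨
    bar (S-fam a) C ∎
  where
  open ≡-Reasoning
  add≡flip : ∀ A → absent A a * e (A ∪ ⁅ a ⁆) C ≡ absent A a * e (A ⊕ ⁅ a ⁆) C
  add≡flip A with lookup A a in a∈?A
  ... | false = cong (λ X → 1ℚ * e X C) (∪⁅i⁆≡⊕⁅i⁆ A a a∈?A)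
  ... | true  = trans (ℚ.*-zeroˡ (e (A ∪ ⁅ a ⁆) C)) (sym (ℚ.*-zeroˡ (e (A ⊕ ⁅ a ⁆) C)))
  flipped : sumℚ (allSubsets n) (λ A → e (A ⊕ ⁅ a ⁆) C * absent A a) ≡ 𝟙 (lookup C a)
  flipped = begin
      sumℚ (allSubsets n) (λ A → e (A ⊕ ⁅ a ⁆) C * absent A a)
    ≡⟨ sumℚ-cong (allSubsets n) (λ A → cong (λ X → e (A ⊕ ⁅ a ⁆) C * absent X a) (sym (⊕-cancelʳ A ⁅ a ⁆))) ⟩
      sumℚ (allSubsets n) (λ A → e (A ⊕ ⁅ a ⁆) C * absent ((A ⊕ ⁅ a ⁆) ⊕ ⁅ a ⁆) a)
    ≡⟨ sumℚ-allSubsets-⊕ ⁅ a ⁆ (λ Y → e Y C * absent (Y ⊕ ⁅ a ⁆) a) ⟨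
      sumℚ (allSubsets n) (λ Y → e Y C * absent (Y ⊕ ⁅ a ⁆) a)
    ≡⟨ sumℚ-allSubsets-e C (λ Y → absent (Y ⊕ ⁅ a ⁆) a) ⟩
      𝟙 (not (lookup (C ⊕ ⁅ a ⁆) a))
    ≡⟨ cong 𝟙 (trans (cong not (lookup-⊕⁅i⁆-i C a)) (not-involutive (lookup C a))) ⟩
      𝟙 (lookup C a) ∎

onUp : ∀ {n} → (Fin n → Subset n → ℚ) → Subset n → Subset n → ℚ
onUp {n} g A B = sumℚ (allFin n) (λ a → 𝟙 (eqSub (A ∪ ⁅ a ⁆) B) * (absent A a * g a A))

0≤onUp : ∀ {n} (g : Fin n → Subset n → ℚ) → (∀ a A → a ∉ A → 0ℚ ≤ g a A) → ∀ A B → 0ℚ ≤ onUp g A B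
0≤onUp {n} g 0≤g A B = sumℚ-nonneg (allFin n) (λ a → 0≤*0≤⇒0≤* (0≤𝟙 (eqSub (A ∪ ⁅ a ⁆) B)) (0≤absent*g a))
  where
  0≤absent*g : ∀ a → 0ℚ ≤ absent A a * g a A
  0≤absent*g a with lookup A a in a∈?A
  ... | true  = ℚ.≤-reflexive (sym (ℚ.*-zeroˡ (g a A)))
  ... | false = 0≤*0≤⇒0≤* (0≤𝟙 true) (0≤g a A (λ a∈A → contradiction (trans (sym ([]=⇒lookup a∈A)) a∈?A) λ ()))

subB-∪ : ∀ {n} (A Y : Subset n) → subB A (A ∪ Y) ≡ true
subB-∪ []          []      = refl
subB-∪ (true  ∷ A) (_ ∷ Y) = subB-∪ A Y
subB-∪ (false ∷ A) (_ ∷ Y) = subB-∪ A Y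

sumℚ-⊆-onUp : ∀ {n} (g : Fin n → Subset n → ℚ) (h : Subset n → Subset n → ℚ) →
  sumℚ (allSubsets n) (λ A → sumℚ (filterB (subB A) (allSubsets n)) (λ B → onUp g A B * h A B))
    ≡ sumUp (λ a A → g a A * h A (A ∪ ⁅ a ⁆))
sumℚ-⊆-onUp {n} g h = trans (sumℚ-cong (allSubsets n) above)
  (sumℚ-swap (allSubsets n) (allFin n) (λ A a → absent A a * (g a A * h A (A ∪ ⁅ a ⁆))))
  where
  open ≡-Reasoning
  term : Subset n → Fin n → Subset n → ℚ
  term A a B = 𝟙 (subB A B) * (absent A a * g a A) * h A B
  above : ∀ A → sumℚ (filterB (subB A) (allSubsets n)) (λ B → onUp g A B * h A B)
              ≡ sumℚ (allFin n) (λ a → absent A a * (g a A * h A (A ∪ ⁅ a ⁆)))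
  above A = begin
      sumℚ (filterB (subB A) (allSubsets n)) (λ B → onUp g A B * h A B)
    ≡⟨ sumℚ-filterB (subB A) (allSubsets n) (λ B → onUp g A B * h A B) ⟩
      sumℚ (allSubsets n) (λ B → 𝟙 (subB A B) * (onUp g A B * h A B))
    ≡⟨ sumℚ-cong (allSubsets n) expand ⟩
      sumℚ (allSubsets n) (λ B → sumℚ (allFin n) (λ a → e (A ∪ ⁅ a ⁆) B * term A a B))
    ≡⟨ sumℚ-swap (allSubsets n) (allFin n) (λ B a → e (A ∪ ⁅ a ⁆) B * term A a B) ⟩
      sumℚ (allFin n) (λ a → sumℚ (allSubsets n) (λ B → e (A ∪ ⁅ a ⁆) B * term A a B))
    ≡⟨ sumℚ-cong (allFin n) (λ a → sumℚ-allSubsets-e′ (A ∪ ⁅ a ⁆) (term A a)) ⟩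
      sumℚ (allFin n) (λ a → term A a (A ∪ ⁅ a ⁆))
    ≡⟨ sumℚ-cong (allFin n) (λ a → trans (cong (λ b → 𝟙 b * (absent A a * g a A) * h A (A ∪ ⁅ a ⁆)) (subB-∪ A ⁅ a ⁆))
         (solve 3 (λ x p q → con 1ℚ :* (x :* p) :* q := x :* (p :* q)) refl (absent A a) (g a A) (h A (A ∪ ⁅ a ⁆)))) ⟩
      sumℚ (allFin n) (λ a → absent A a * (g a A * h A (A ∪ ⁅ a ⁆))) ∎
    where
    expand : ∀ B → 𝟙 (subB A B) * (onUp g A B * h A B) ≡ sumℚ (allFin n) (λ a → e (A ∪ ⁅ a ⁆) B * term A a B)
    expand B = begin
        𝟙 (subB A B) * (onUp g A B * h A B)
      ≡⟨ cong (λ t → 𝟙 (subB A B) * t) (sumℚ-*ʳ (allFin n) (h A B) (λ a → 𝟙 (eqSub (A ∪ ⁅ a ⁆) B) * (absent A a * g a A))) ⟨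
        𝟙 (subB A B) * sumℚ (allFin n) (λ a → 𝟙 (eqSub (A ∪ ⁅ a ⁆) B) * (absent A a * g a A) * h A B)
      ≡⟨ sumℚ-*ˡ (allFin n) (𝟙 (subB A B)) (λ a → 𝟙 (eqSub (A ∪ ⁅ a ⁆) B) * (absent A a * g a A) * h A B) ⟨
        sumℚ (allFin n) (λ a → 𝟙 (subB A B) * (𝟙 (eqSub (A ∪ ⁅ a ⁆) B) * (absent A a * g a A) * h A B))
      ≡⟨ sumℚ-cong (allFin n) (λ a → trans
           (solve 4 (λ s q k r → s :* (q :* k :* r) := q :* (s :* k :* r)) refl
              (𝟙 (subB A B)) (𝟙 (eqSub (A ∪ ⁅ a ⁆) B)) (absent A a * g a A) (h A B))
           (cong (_* term A a B) (sym (e≡𝟙eqSub (A ∪ ⁅ a ⁆) B)))) ⟩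
        sumℚ (allFin n) (λ a → e (A ∪ ⁅ a ⁆) B * term A a B) ∎

module Decomposition {n} (n≥1 : n ≥ 1) (F : Family n) (maximal : MaximalIntersecting F) (∅-minimal : EmptyMinimal F) where

  N : ℚ
  N = #perms n

  N>0 : Positive N
  N>0 = positive (ℚ.<-≤-trans (ℚ.positive⁻¹ 1ℚ) (1≤#perms n))

  instance
    N≢0 : NonZero N
    N≢0 = ℚ.pos⇒nonZero N {{N>0}}

  0≤1/N : 0ℚ ≤ 1/ N
  0≤1/N = ℚ.nonNegative⁻¹ (1/ N) {{ℚ.pos⇒nonNeg (1/ N) {{ℚ.1/pos⇒pos N {{N>0}}}}}}

  Λ∅ : Fin n → ℚ
  Λ∅ a = Λℚ (star F) ⊥ ⁅ a ⁆

  c : Fin n → ℚ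
  c a = Λ∅ a * 1/ N

  gap : Fin n → Subset n → ℚ
  gap a A = (Λℚ (star F) A (A ∪ ⁅ a ⁆) - Λ∅ a) * 1/ N

  λ′ : Subset n → Subset n → ℚ
  λ′ = onUp gap

  0≤c : ∀ a → 0ℚ ≤ c a
  0≤c a = 0≤*0≤⇒0≤* (0≤Λℚ-⊥-⁅⁆ a (star-downClosed maximal)) 0≤1/N

  0≤λ′ : ∀ A B → subB A B ≡ true → 0ℚ ≤ λ′ A B
  0≤λ′ A B _ = 0≤onUp gap (λ a A a∉A → 0≤*0≤⇒0≤* (p≤q⇒0≤q-p (fromℤ-mono-≤ (∅-minimal a A a∉A))) 0≤1/N) A B

  sumℚ-Λ∅ : sumℚ (allFin n) Λ∅ ≡ N
  sumℚ-Λ∅ = ℚ.neg-injective (begin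
      - sumℚ (allFin n) Λ∅
    ≡⟨ cong -_ (sumℚ-cong (allFin n) (λ a → cong (Λℚ (star F) ⊥) (∪-identityˡ ⁅ a ⁆))) ⟨
      - sumℚ (allFin n) (λ a → Λℚ (star F) ⊥ (⊥ ∪ ⁅ a ⁆))
    ≡⟨ sumUp-Δe-⊥ (λ a A → Λℚ (star F) A (A ∪ ⁅ a ⁆)) ⟨
      sumUp (λ a A → Λℚ (star F) A (A ∪ ⁅ a ⁆) * Δe A (A ∪ ⁅ a ⁆) ⊥)
    ≡⟨ Λ-identity F ⊥ ⟨
      N * bar F ⊥
    ≡⟨ cong (N *_) (bar-⊥ maximal n≥1) ⟩
      N * - 1ℚ
    ≡⟨ solve 1 (λ x → x :* :- con 1ℚ := :- x) refl N ⟩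
      - N ∎)
    where open ≡-Reasoning

  sumℚ-c : sumℚ (allFin n) c ≡ 1ℚ
  sumℚ-c = trans (sumℚ-*ʳ (allFin n) (1/ N) Λ∅) (trans (cong (_* 1/ N) sumℚ-Λ∅) (ℚ.*-inverseʳ N))

  decomposition : ∀ C → bar F C ≡ sumℚ (allFin n) (λ a → c a * bar (S-fam a) C)
    + sumℚ (allSubsets n) (λ A → sumℚ (filterB (subB A) (allSubsets n)) (λ B → λ′ A B * (e B C - e A C)))
  decomposition C = sym (begin
      S + sumℚ (allSubsets n) (λ A → sumℚ (filterB (subB A) (allSubsets n)) (λ B → λ′ A B * Δe A B C))
    ≡⟨ cong (S +_) (sumℚ-⊆-onUp gap (λ A B → Δe A B C)) ⟩
      S + sumUp (λ a A → gap a A * Δe A (A ∪ ⁅ a ⁆) C)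
    ≡⟨ cong (S +_) (trans (sumUp-cong split) (sumUp-diff (λ a A → 1/ N * ΛΔe a A) (λ a A → c a * Δe A (A ∪ ⁅ a ⁆) C))) ⟩
      S + (sumUp (λ a A → 1/ N * ΛΔe a A) - sumUp (λ a A → c a * Δe A (A ∪ ⁅ a ⁆) C))
    ≡⟨ cong₂ (λ x y → S + (x - y)) scaled bars ⟩
      S + (1/ N * (N * bar F C) - S)
    ≡⟨ solve 4 (λ s i nn b → s :+ (i :* (nn :* b) :- s) := (nn :* i) :* b) refl S (1/ N) N (bar F C) ⟩
      (N * 1/ N) * bar F C
    ≡⟨ trans (cong (_* bar F C) (ℚ.*-inverseʳ N)) (ℚ.*-identityˡ (bar F C)) ⟩
      bar F C ∎)
    where
    open ≡-Reasoning
    S = sumℚ (allFin n) (λ a → c a * bar (S-fam a) C)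
    ΛΔe : Fin n → Subset n → ℚ
    ΛΔe a A = Λℚ (star F) A (A ∪ ⁅ a ⁆) * Δe A (A ∪ ⁅ a ⁆) C
    split : ∀ a A → gap a A * Δe A (A ∪ ⁅ a ⁆) C ≡ 1/ N * ΛΔe a A - c a * Δe A (A ∪ ⁅ a ⁆) C
    split a A = solve 4 (λ l μ i d → (l :- μ) :* i :* d := i :* (l :* d) :- μ :* i :* d) refl
      (Λℚ (star F) A (A ∪ ⁅ a ⁆)) (Λ∅ a) (1/ N) (Δe A (A ∪ ⁅ a ⁆) C)
    scaled : sumUp (λ a A → 1/ N * ΛΔe a A) ≡ 1/ N * (N * bar F C)
    scaled = trans (sumUp-*ˡ (λ _ → 1/ N) ΛΔe)
      (trans (sumℚ-*ˡ (allFin n) (1/ N) (λ a → sumℚ (allSubsets n) (λ A → absent A a * ΛΔe a A)))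
             (cong (1/ N *_) (sym (Λ-identity F C))))
    bars : sumUp (λ a A → c a * Δe A (A ∪ ⁅ a ⁆) C) ≡ S
    bars = trans (sumUp-*ˡ c (λ a A → Δe A (A ∪ ⁅ a ⁆) C)) (sumℚ-cong (allFin n) (λ a → cong (c a *_) (bar-S-fam a C)))

mainTheorem6 : ∀ (n : ℕ) → n ≥ 1 → (F : Family n) →
    MaximalIntersecting F → EmptyMinimal F →
    Σ (Fin n → ℚ) λ c → Σ (Subset n → Subset n → ℚ) λ λ' →
      (∀ a → 0ℚ ≤ c a) ×
      (sumℚ (allFin n) c ≡ 1ℚ) ×
      (∀ A B → subB A B ≡ true → 0ℚ ≤ λ' A B) ×
      (∀ C → bar F C ≡
         sumℚ (allFin n) (λ a → c a * bar (S-fam a) C)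
         + sumℚ (allSubsets n) (λ A → sumℚ (filterB (subB A) (allSubsets n))
              (λ B → λ' A B * (e B C - e A C))))
mainTheorem6 n n≥1 F mi em = c , λ′ , 0≤c , sumℚ-c , 0≤λ′ , decomposition
  where open Decomposition n≥1 F mi em
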